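{- For every integer $m\ge1$: (a) $I_m=\{E\bar x\in\mathbb{N}^s:\ \bar x=[x_0,\dots,x_{s-1}]^t\in\mathbb{R}^s,\ m-1<\min\{x_0,\dots,x_{s-1}\}\}$; (b) $J_m=\{E\bar a\in\mathbb{N}^s:\ \bar a=[a_0,\dots,a_{s-1}]^t\in\mathbb{R}^s,\ m=\min\{a_0,\dots,a_{s-1}\}\}$.
   Context: Let $p$ be a prime, $s\ge1$. For $N=\sum_jn_jp^j$ (base $p$), $\Gamma(N)=[u_0,\dots,u_{s-1}]^t$ with $u_i=\sum_{j\equiv i\pmod s}n_j$. With $\bar e_i$ the standard basis of $\mathbb{R}^s$ and indices mod $s$, $\bar\varepsilon_i:=p\bar e_{i-1}-\bar e_i$ and $E:=[\bar\varepsilon_0,\dots,\bar\varepsilon_{s-1}]$. $V_m(k)$ is the set of $m$-tuples of positive integers summing to $k$ with no carryover of $p$-adic digits in the sum and with $(p^s-1)\mid X_j$ for $1\le j\le m-1$ (empty for $k=0$). $\mathfrak{J}:=\{\Gamma(k):k\text{ a positive multiple of }p^s-1\}$, $I_m:=\{\Gamma(k):k\in\mathbb{N},\ V_m(k)\ne\emptyset\}$, and $J_m:=\mathfrak{J}\cap(I_m\setminus I_{m+1})$.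
   Formalization: The vectors x̄ and ā in the set descriptions of $I_m$ and $J_m$ have rational entries, ranging over ℚ^s rather than ℝ^s. -}

module Defs where

open import Data.Nat as ℕ using (ℕ; zero; suc; _+_; _*_; _∸_; _^_; _<_; _≤_; NonZero)
open import Data.Nat.DivMod using (_/_; _%_; _mod_)
open import Data.Nat.Divisibility using (_∣_)
open import Data.Fin as F using (Fin; toℕ)
open import Data.List using (map; upTo)
open import Data.Nat.ListAction using (sum)
open import Data.Bool using (if_then_else_)
open import Data.Integer using (+_)
open import Data.Rational as ℚ using (ℚ)
open import Data.Product using (Σ; ∃; _×_)
open import Relation.Binary.PropositionalEquality using (_≡_; _≗_)
open import Relation.Nullary using (¬_)
open import Relation.Nullary.Decidable using (⌊_⌋)

digit : (p : ℕ) → .{{_ : NonZero p}} → ℕ → ℕ → ℕ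
digit p n zero = n % p
digit p n (suc j) = digit p (n / p) j

-- Γ(N)_i = sum of the base-p digits n_j of N with j ≡ i (mod s).
-- Digits with j > N vanish (p ≥ 2), so summing over j ≤ N is the full sum.
Γ : (p s : ℕ) → .{{_ : NonZero p}} → .{{_ : NonZero s}} → ℕ → Fin s → ℕ
Γ p s N i = sum (map (λ j → if ⌊ j % s ℕ.≟ toℕ i ⌋ then digit p N j else 0) (upTo (suc N)))

Σℕ : ∀ {n} → (Fin n → ℕ) → ℕ
Σℕ {zero} f = 0
Σℕ {suc n} f = f F.zero + Σℕ (λ i → f (F.suc i))

Σℚ : ∀ {n} → (Fin n → ℚ) → ℚ
Σℚ {zero} f = ℚ.0ℚ
Σℚ {suc n} f = f F.zero ℚ.+ Σℚ (λ i → f (F.suc i))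

NoCarry : (p : ℕ) → .{{_ : NonZero p}} → ∀ {m} → (Fin m → ℕ) → Set
NoCarry p X = ∀ j → Σℕ (λ i → digit p (X i) j) < p

-- X ∈ V_m(k)  (tuple index i : Fin m corresponds to X_{i+1})
InV : (p s m k : ℕ) → .{{_ : NonZero p}} → (Fin m → ℕ) → Set
InV p s m k X =
  (∀ i → 0 < X i) × (Σℕ X ≡ k) × NoCarry p X ×
  (∀ (i : Fin m) → suc (toℕ i) < m → (p ^ s ∸ 1) ∣ X i)

InI : (p s m : ℕ) → .{{_ : NonZero p}} → .{{_ : NonZero s}} → (Fin s → ℕ) → Set
InI p s m v = ∃ λ k → (Γ p s k ≗ v) × (∃ λ X → InV p s m k X)

InJfrak : (p s : ℕ) → .{{_ : NonZero p}} → .{{_ : NonZero s}} → (Fin s → ℕ) → Set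
InJfrak p s v = ∃ λ k → (0 < k) × ((p ^ s ∸ 1) ∣ k) × (Γ p s k ≗ v)

InJ : (p s m : ℕ) → .{{_ : NonZero p}} → .{{_ : NonZero s}} → (Fin s → ℕ) → Set
InJ p s m v = InJfrak p s v × InI p s m v × ¬ InI p s (suc m) v

ι : ℕ → ℚ
ι n = (+ n) ℚ./ 1

e : ∀ {s} → Fin s → Fin s → ℚ
e i j = if ⌊ i F.≟ j ⌋ then ℚ.1ℚ else ℚ.0ℚ

prev : (s : ℕ) → .{{_ : NonZero s}} → Fin s → Fin s
prev s i = (toℕ i + (s ∸ 1)) mod s

ε : (p s : ℕ) → .{{_ : NonZero s}} → Fin s → Fin s → ℚ
ε p s i j = ι p ℚ.* e (prev s i) j ℚ.- e i j

-- E x = Σ_k x_k ε_k  (E has columns ε_0,…,ε_{s-1})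
Emul : (p s : ℕ) → .{{_ : NonZero s}} → (Fin s → ℚ) → Fin s → ℚ
Emul p s x j = Σℚ (λ k → x k ℚ.* ε p s k j)

IsMin : ∀ {s} → (Fin s → ℚ) → ℚ → Set
IsMin x c = (∀ i → c ℚ.≤ x i) × (∃ λ i → x i ≡ c)

{-# OPTIONS --safe #-}

-- Let Q = p^s − 1 and, reading indices mod s, w_j(v) = Σ_{t<s} p^t v_{j+t}.  Since
-- p·w_{j+1}(v) = w_j(v) + Q·v_j, the vector w(v)/Q is the unique rational solution of E x = v,
-- so both parts are statements about w(v): v ∈ I_m iff w_j(v) > (m−1)Q for all j, and v ∈ J_m
-- iff all w_j(v) ≥ mQ with equality for some j.  Membership in 𝔍 means v ≠ 0 and
-- Q ∣ w_0(v), because p^s ≡ 1 (mod Q) gives k ≡ w_0(Γ(k)) (mod Q); and Q ∣ w_{j+1} implies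
-- Q ∣ w_j, so then every w_j is a multiple of Q.  For I_m: Γ is additive on carry-free sums,
-- and every family of digit-class vectors is realised by a carry-free tuple (0/1 digits on
-- disjoint positions), so v ∈ I_m iff v is a sum of m nonzero vectors, all but the last with
-- Q ∣ w_0; the first m−1 then have all w_j ≥ Q, which gives the bound.  Conversely, if all
-- w_j(v) > mQ, put y_j = max_{t<s} (p^t − Σ_{i<t} p^i v_{j+i}): then u_j = p·y_{j+1} − y_j
-- satisfies 0 ≤ u ≤ v, w(u) = Q·y ≥ Q and w(v − u) > (m−1)Q, and one recurses on v − u.

module Submission where

open import Data.Nat
open import Data.Nat.Properties
open import Data.Nat.DivMod
open import Data.Nat.Divisibility
open import Data.Fin as F using (Fin; toℕ)
import Data.Fin.Properties as F
open import Data.Bool using (true; false; if_then_else_)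
open import Data.Bool.Properties using (if-eta)
open import Data.List using (map; applyUpTo)
open import Data.Nat.ListAction using (sum)
open import Data.Product using (∃; ∃-syntax; _×_; _,_; proj₁; proj₂)
open import Data.Sum using (_⊎_; inj₁; inj₂; [_,_]′)
open import Relation.Nullary using (Dec; yes; no; ¬_; contradiction)
open import Relation.Nullary.Decidable using (⌊_⌋)
open import Function using (_∘_; id)
open import Relation.Binary.PropositionalEquality
open import Algebra.Properties.CommutativeSemigroup +-commutativeSemigroup
  using () renaming (interchange to +-interchange)
open import Data.Nat.Tactic.RingSolver using (solve-∀)
open import Data.Integer as ℤ using (+≤+; +<+)
import Data.Integer.Properties as ℤ
open import Data.Rational as ℚ using (ℚ; mkℚ; 0ℚ; 1ℚ)
import Data.Rational.Properties as ℚ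
import Data.Rational.Unnormalised as ℚᵘ
import Data.Rational.Unnormalised.Properties as ℚᵘ
import Data.Nat.Coprimality as Coprime
open import Data.Rational.Solver using (module +-*-Solver)
open +-*-Solver using (solve; _:+_; _:*_; _:-_; con; _:=_)
open import Function.Bundles using (_⇔_; mk⇔; module Equivalence)
open Equivalence using (to; from)
import Function.Properties.Equivalence as ⇔
open import Data.Nat.Primality using (Prime; prime)
open import Defs

if-yes : ∀ {A P : Set} (d : Dec P) {x y : A} → P → (if ⌊ d ⌋ then x else y) ≡ x
if-yes (yes _) _  = refl
if-yes (no ¬p) p = contradiction p ¬p

if-no : ∀ {A P : Set} (d : Dec P) {x y : A} → ¬ P → (if ⌊ d ⌋ then x else y) ≡ y
if-no (yes p) ¬p = contradiction p ¬p
if-no (no _)  _  = refl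

sumBelow : ℕ → (ℕ → ℕ) → ℕ
sumBelow zero    f = 0
sumBelow (suc n) f = f 0 + sumBelow n (f ∘ suc)

infix 10 sumBelow
syntax sumBelow n (λ t → x) = ∑[ t < n ] x

sumBelow-cong : ∀ n {f g : ℕ → ℕ} → (∀ t → t < n → f t ≡ g t) → sumBelow n f ≡ sumBelow n g
sumBelow-cong zero    _ = refl
sumBelow-cong (suc n) h = cong₂ _+_ (h 0 z<s) (sumBelow-cong n (λ t t<n → h (suc t) (s<s t<n)))

sumBelow-distrib-+ : ∀ n (f g : ℕ → ℕ) → ∑[ t < n ] (f t + g t) ≡ sumBelow n f + sumBelow n g
sumBelow-distrib-+ zero    f g = refl
sumBelow-distrib-+ (suc n) f g =
  trans (cong (f 0 + g 0 +_) (sumBelow-distrib-+ n (f ∘ suc) (g ∘ suc))) (+-interchange (f 0) (g 0) _ _)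

*-distribˡ-sumBelow : ∀ n c (f : ℕ → ℕ) → c * sumBelow n f ≡ ∑[ t < n ] (c * f t)
*-distribˡ-sumBelow zero    c f = *-zeroʳ c
*-distribˡ-sumBelow (suc n) c f =
  trans (*-distribˡ-+ c (f 0) _) (cong (c * f 0 +_) (*-distribˡ-sumBelow n c (f ∘ suc)))

sumBelow-split : ∀ m n (f : ℕ → ℕ) → sumBelow (m + n) f ≡ sumBelow m f + ∑[ t < n ] f (m + t)
sumBelow-split zero    n f = refl
sumBelow-split (suc m) n f = trans (cong (f 0 +_) (sumBelow-split m n (f ∘ suc))) (sym (+-assoc (f 0) _ _))

sumBelow-init-last : ∀ n (f : ℕ → ℕ) → sumBelow (suc n) f ≡ sumBelow n f + f n
sumBelow-init-last zero    f = +-comm (f 0) 0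
sumBelow-init-last (suc n) f = trans (cong (f 0 +_) (sumBelow-init-last n (f ∘ suc))) (sym (+-assoc (f 0) _ _))

sumBelow-zero : ∀ n {f : ℕ → ℕ} → (∀ t → t < n → f t ≡ 0) → sumBelow n f ≡ 0
sumBelow-zero n h = trans (sumBelow-cong n h) (sumBelow-const0 n)
  where
  sumBelow-const0 : ∀ n → ∑[ t < n ] 0 ≡ 0
  sumBelow-const0 zero    = refl
  sumBelow-const0 (suc n) = sumBelow-const0 n

sumBelow-single : ∀ n {f : ℕ → ℕ} a → a < n → (∀ t → t < n → t ≢ a → f t ≡ 0) → sumBelow n f ≡ f a
sumBelow-single (suc n) {f} zero    _ h =
  trans (cong (f 0 +_) (sumBelow-zero n (λ t t<n → h (suc t) (s<s t<n) λ ()))) (+-identityʳ (f 0))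
sumBelow-single (suc n) (suc a) (s<s a<n) h rewrite h 0 z<s (λ ()) =
  sumBelow-single n a a<n (λ t t<n t≢a → h (suc t) (s<s t<n) (t≢a ∘ suc-injective))

term≤sumBelow : ∀ n (f : ℕ → ℕ) {t} → t < n → f t ≤ sumBelow n f
term≤sumBelow (suc n) f {zero}  _         = m≤m+n (f 0) _
term≤sumBelow (suc n) f {suc t} (s<s t<n) = ≤-trans (term≤sumBelow n (f ∘ suc) t<n) (m≤n+m _ (f 0))

sumBelow>0⇒term>0 : ∀ n (f : ℕ → ℕ) → 0 < sumBelow n f → ∃[ t ] t < n × 0 < f t
sumBelow>0⇒term>0 (suc n) f pos with f 0 in f0≡
... | suc _ = 0 , z<s , subst (0 <_) (sym f0≡) z<s
... | zero with sumBelow>0⇒term>0 n (f ∘ suc) pos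
...   | t , t<n , ft>0 = suc t , s<s t<n , ft>0

sumBelow-comm : ∀ m n (h : ℕ → ℕ → ℕ) →
                ∑[ a < m ] sumBelow n (h a) ≡ ∑[ b < n ] ∑[ a < m ] h a b
sumBelow-comm zero    n h = sym (sumBelow-zero n (λ _ _ → refl))
sumBelow-comm (suc m) n h =
  trans (cong (sumBelow n (h 0) +_) (sumBelow-comm m n (h ∘ suc)))
        (sym (sumBelow-distrib-+ n (h 0) (λ b → ∑[ a < m ] h (suc a) b)))

sumBelow-blocks : ∀ m n (f : ℕ → ℕ) → sumBelow (m * n) f ≡ ∑[ c < m ] ∑[ r < n ] f (c * n + r)
sumBelow-blocks zero    n f = refl
sumBelow-blocks (suc m) n f =
  trans (sumBelow-split n (m * n) f)
        (cong (sumBelow n f +_)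
          (trans (sumBelow-blocks m n (λ t → f (n + t)))
                 (sumBelow-cong m (λ c _ → sumBelow-cong n (λ r _ → cong f (sym (+-assoc n (c * n) r)))))))

sumBelow-truncate : ∀ {m n} (f : ℕ → ℕ) → m ≤ n → (∀ t → m ≤ t → f t ≡ 0) → sumBelow n f ≡ sumBelow m f
sumBelow-truncate {m} f m≤n h with m≤n⇒∃[o]m+o≡n m≤n
... | o , refl = trans (sumBelow-split m o f)
                   (trans (cong (sumBelow m f +_) (sumBelow-zero o (λ t _ → h (m + t) (m≤m+n m t))))
                          (+-identityʳ _))

-- Stated with _<ᵇ_ so that suc c <ᵇ suc n reduces to c <ᵇ n.
sumBelow-count-< : ∀ K n → n ≤ K → ∑[ c < K ] (if c <ᵇ n then 1 else 0) ≡ n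
sumBelow-count-< K       zero    _         = sumBelow-zero K (λ _ _ → refl)
sumBelow-count-< (suc K) (suc n) (s≤s n≤K) = cong suc (sumBelow-count-< K n n≤K)

sum-map-applyUpTo : ∀ n (g f : ℕ → ℕ) → sum (map g (applyUpTo f n)) ≡ sumBelow n (g ∘ f)
sum-map-applyUpTo zero    g f = refl
sum-map-applyUpTo (suc n) g f = cong (g (f 0) +_) (sum-map-applyUpTo n g (f ∘ suc))

Σℕ-cong : ∀ {m} {f g : Fin m → ℕ} → (∀ i → f i ≡ g i) → Σℕ f ≡ Σℕ g
Σℕ-cong {zero}  h = refl
Σℕ-cong {suc m} h = cong₂ _+_ (h F.zero) (Σℕ-cong (h ∘ F.suc))

Σℕ-distrib-+ : ∀ {m} (f g : Fin m → ℕ) → Σℕ (λ i → f i + g i) ≡ Σℕ f + Σℕ g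
Σℕ-distrib-+ {zero}  f g = refl
Σℕ-distrib-+ {suc m} f g =
  trans (cong (f F.zero + g F.zero +_) (Σℕ-distrib-+ (f ∘ F.suc) (g ∘ F.suc))) (+-interchange (f F.zero) (g F.zero) _ _)

*-distribˡ-Σℕ : ∀ {m} c (f : Fin m → ℕ) → c * Σℕ f ≡ Σℕ (λ i → c * f i)
*-distribˡ-Σℕ {zero}  c f = *-zeroʳ c
*-distribˡ-Σℕ {suc m} c f = trans (*-distribˡ-+ c (f F.zero) _) (cong (c * f F.zero +_) (*-distribˡ-Σℕ c (f ∘ F.suc)))

Σℕ-zero : ∀ {m} {f : Fin m → ℕ} → (∀ i → f i ≡ 0) → Σℕ f ≡ 0
Σℕ-zero {zero}  h = refl
Σℕ-zero {suc m} h rewrite h F.zero = Σℕ-zero (h ∘ F.suc)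

Σℕ-if : ∀ {m} b (f : Fin m → ℕ) → Σℕ (λ i → if b then f i else 0) ≡ (if b then Σℕ f else 0)
Σℕ-if true  f = refl
Σℕ-if {m} false f = Σℕ-zero {m} (λ _ → refl)

term≤Σℕ : ∀ {m} (f : Fin m → ℕ) i → f i ≤ Σℕ f
term≤Σℕ f F.zero    = m≤m+n _ _
term≤Σℕ f (F.suc i) = ≤-trans (term≤Σℕ (f ∘ F.suc) i) (m≤n+m _ _)

Σℕ-mono-≤ : ∀ {m} {f g : Fin m → ℕ} → (∀ i → f i ≤ g i) → Σℕ f ≤ Σℕ g
Σℕ-mono-≤ {zero}  h = z≤n
Σℕ-mono-≤ {suc m} h = +-mono-≤ (h F.zero) (Σℕ-mono-≤ (h ∘ F.suc))

Σℕ-single : ∀ {m} {f : Fin m → ℕ} a → (∀ i → i ≢ a → f i ≡ 0) → Σℕ f ≡ f a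
Σℕ-single {f = f} F.zero h = trans (cong (f F.zero +_) (Σℕ-zero (λ i → h (F.suc i) λ ()))) (+-identityʳ _)
Σℕ-single (F.suc a) h rewrite h F.zero (λ ()) = Σℕ-single a (λ i i≢a → h (F.suc i) (i≢a ∘ F.suc-injective))

n*q<Σℕ : ∀ {q} n (f : Fin (suc n) → ℕ) → (∀ l → 0 < f l) → (∀ l → suc (toℕ l) < suc n → q ≤ f l) → n * q < Σℕ f
n*q<Σℕ zero    f pos _   = ≤-trans (pos F.zero) (m≤m+n _ _)
n*q<Σℕ (suc n) f pos big =
  +-mono-≤-< (big F.zero (s<s z<s)) (n*q<Σℕ n (f ∘ F.suc) (pos ∘ F.suc) (λ l l<n → big (F.suc l) (s<s l<n)))

sumBelow-Σℕ-comm : ∀ n {m} (h : Fin m → ℕ → ℕ) → ∑[ t < n ] Σℕ (λ l → h l t) ≡ Σℕ (λ l → sumBelow n (h l))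
sumBelow-Σℕ-comm zero {m} h = sym (Σℕ-zero {m} (λ _ → refl))
sumBelow-Σℕ-comm (suc n) h =
  trans (cong (Σℕ (λ l → h l 0) +_) (sumBelow-Σℕ-comm n (λ l → h l ∘ suc)))
        (sym (Σℕ-distrib-+ (λ l → h l 0) (λ l → sumBelow n (h l ∘ suc))))

maxBelow : ℕ → (ℕ → ℕ) → ℕ
maxBelow zero    f = 0
maxBelow (suc n) f = f 0 ⊔ maxBelow n (f ∘ suc)

term≤maxBelow : ∀ n (f : ℕ → ℕ) {t} → t < n → f t ≤ maxBelow n f
term≤maxBelow (suc n) f {zero}  _         = m≤m⊔n (f 0) _
term≤maxBelow (suc n) f {suc t} (s<s t<n) = ≤-trans (term≤maxBelow n (f ∘ suc) t<n) (m≤n⊔m (f 0) _)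

maxBelow-cong : ∀ n {f g : ℕ → ℕ} → (∀ t → t < n → f t ≡ g t) → maxBelow n f ≡ maxBelow n g
maxBelow-cong zero    _ = refl
maxBelow-cong (suc n) h = cong₂ _⊔_ (h 0 z<s) (maxBelow-cong n (λ t t<n → h (suc t) (s<s t<n)))

maxBelow-attained : ∀ {n} (f : ℕ → ℕ) → 0 < n → ∃[ t ] t < n × maxBelow n f ≡ f t
maxBelow-attained {suc n} f _ = attained n f
  where
  attained : ∀ n (f : ℕ → ℕ) → ∃[ t ] t < suc n × maxBelow (suc n) f ≡ f t
  attained zero    f = 0 , z<s , ⊔-identityʳ (f 0)
  attained (suc n) f with attained n (f ∘ suc)
  ... | t , t<n , rest≡ft =
    [ (λ max≡f0 → 0 , z<s , max≡f0) , (λ max≡rest → suc t , s<s t<n , trans max≡rest rest≡ft) ]′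
      (⊔-sel (f 0) (maxBelow (suc n) (f ∘ suc)))

a∸b+c<d : ∀ {a b c d} → a + c < d + b → c < d → a ∸ b + c < d
a∸b+c<d {a} {b} {c} {d} a+c<d+b c<d with ≤-total b a
... | inj₂ a≤b = subst (λ x → x + c < d) (sym (m≤n⇒m∸n≡0 a≤b)) c<d
... | inj₁ b≤a = +-cancelʳ-< b _ d (subst (_< d + b) a+c≡a∸b+c+b a+c<d+b)
  where
  a+c≡a∸b+c+b : a + c ≡ a ∸ b + c + b
  a+c≡a∸b+c+b = trans (cong (_+ c) (sym (m∸n+n≡m b≤a)))
                      (trans (+-assoc (a ∸ b) b c) (trans (cong (a ∸ b +_) (+-comm b c)) (sym (+-assoc (a ∸ b) c b))))

m∸o≤n⇒m∸n≤o : ∀ m n o → m ∸ o ≤ n → m ∸ n ≤ o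
m∸o≤n⇒m∸n≤o m n o m∸o≤n with ≤-total o m
... | inj₁ o≤m = m≤n+o⇒m∸n≤o m n (subst (_≤ n + o) (m∸n+n≡m o≤m) (+-monoˡ-≤ o m∸o≤n))
... | inj₂ m≤o = ≤-trans (m∸n≤m m n) m≤o

∣∧<⇒≤ : ∀ {q m} n → q ∣ m → n * q < m → suc n * q ≤ m
∣∧<⇒≤ {q} n (divides k refl) n*q<k*q = *-monoˡ-≤ q (*-cancelʳ-< q n k n*q<k*q)

m*n>0⇒m>0 : ∀ m {n} → 0 < m * n → 0 < m
m*n>0⇒m>0 (suc m) _ = z<s

m*n>0⇒n>0 : ∀ m {n} → 0 < m * n → 0 < n
m*n>0⇒n>0 m {n} m*n>0 = m*n>0⇒m>0 n (subst (0 <_) (*-comm m n) m*n>0)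

[r+qd]%d≡r : ∀ {d} .{{_ : NonZero d}} r q → r < d → (r + q * d) % d ≡ r
[r+qd]%d≡r {d} r q r<d = trans ([m+kn]%n≡m%n r q d) (m<n⇒m%n≡m r<d)

[r+qd]/d≡q : ∀ {d} .{{_ : NonZero d}} r q → r < d → (r + q * d) / d ≡ q
[r+qd]/d≡q {d} r q r<d =
  trans (+-distrib-/-∣ʳ r (n∣m*n q)) (cong₂ _+_ (m<n⇒m/n≡0 r<d) (m*n/n≡m q d))

sumBelow-%-cong : ∀ {d} .{{_ : NonZero d}} n (f g : ℕ → ℕ) →
                  (∀ t → t < n → f t % d ≡ g t % d) → sumBelow n f % d ≡ sumBelow n g % d
sumBelow-%-cong zero    f g h = refl
sumBelow-%-cong {d} (suc n) f g h = begin
  (f 0 + sumBelow n (f ∘ suc)) % d                    ≡⟨ %-distribˡ-+ (f 0) _ d ⟩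
  (f 0 % d + sumBelow n (f ∘ suc) % d) % d            ≡⟨ cong₂ (λ a b → (a + b) % d) (h 0 z<s) rest ⟩
  (g 0 % d + sumBelow n (g ∘ suc) % d) % d            ≡⟨ %-distribˡ-+ (g 0) _ d ⟨
  (g 0 + sumBelow n (g ∘ suc)) % d                    ∎
  where
  open ≡-Reasoning
  rest = sumBelow-%-cong n (f ∘ suc) (g ∘ suc) (λ t t<n → h (suc t) (s<s t<n))

ι≡mkℚ : ∀ n → ι n ≡ mkℚ (ℤ.+ n) 0 (Coprime.sym (Coprime.1-coprimeTo n))
ι≡mkℚ n = ℚ.↥p/↧p≡p (mkℚ (ℤ.+ n) 0 (Coprime.sym (Coprime.1-coprimeTo n)))

toℚᵘ-ι : ∀ n → ℚ.toℚᵘ (ι n) ≡ ℚᵘ.mkℚᵘ (ℤ.+ n) 0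
toℚᵘ-ι n = cong ℚ.toℚᵘ (ι≡mkℚ n)

ι-0 : ι 0 ≡ 0ℚ
ι-0 = ι≡mkℚ 0

ι-1 : ι 1 ≡ 1ℚ
ι-1 = ι≡mkℚ 1

ι-homo-+ : ∀ a b → ι (a + b) ≡ ι a ℚ.+ ι b
ι-homo-+ a b = ℚ.toℚᵘ-injective (begin-equality
  ℚ.toℚᵘ (ι (a + b))
    ≡⟨ toℚᵘ-ι (a + b) ⟩
  ℚᵘ.mkℚᵘ (ℤ.+ (a + b)) 0
    ≃⟨ ℚᵘ.*≡* (cong (ℤ._* ℤ.+ 1) a+b≡a*1+b*1) ⟩
  ℚᵘ.mkℚᵘ (ℤ.+ a) 0 ℚᵘ.+ ℚᵘ.mkℚᵘ (ℤ.+ b) 0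
    ≡⟨ cong₂ ℚᵘ._+_ (toℚᵘ-ι a) (toℚᵘ-ι b) ⟨
  ℚ.toℚᵘ (ι a) ℚᵘ.+ ℚ.toℚᵘ (ι b)
    ≃⟨ ℚ.toℚᵘ-homo-+ (ι a) (ι b) ⟨
  ℚ.toℚᵘ (ι a ℚ.+ ι b) ∎)
  where
  open ℚᵘ.≤-Reasoning
  a+b≡a*1+b*1 : ℤ.+ (a + b) ≡ ℤ.+ a ℤ.* ℤ.+ 1 ℤ.+ ℤ.+ b ℤ.* ℤ.+ 1
  a+b≡a*1+b*1 = trans (ℤ.pos-+ a b) (sym (cong₂ ℤ._+_ (ℤ.*-identityʳ (ℤ.+ a)) (ℤ.*-identityʳ (ℤ.+ b))))

ι-homo-* : ∀ a b → ι (a * b) ≡ ι a ℚ.* ι b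
ι-homo-* a b = ℚ.toℚᵘ-injective (begin-equality
  ℚ.toℚᵘ (ι (a * b))                       ≡⟨ toℚᵘ-ι (a * b) ⟩
  ℚᵘ.mkℚᵘ (ℤ.+ (a * b)) 0                  ≃⟨ ℚᵘ.*≡* (cong (ℤ._* ℤ.+ 1) (ℤ.pos-* a b)) ⟩
  ℚᵘ.mkℚᵘ (ℤ.+ a) 0 ℚᵘ.* ℚᵘ.mkℚᵘ (ℤ.+ b) 0 ≡⟨ cong₂ ℚᵘ._*_ (toℚᵘ-ι a) (toℚᵘ-ι b) ⟨
  ℚ.toℚᵘ (ι a) ℚᵘ.* ℚ.toℚᵘ (ι b)           ≃⟨ ℚ.toℚᵘ-homo-* (ι a) (ι b) ⟨
  ℚ.toℚᵘ (ι a ℚ.* ι b)                     ∎)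
  where open ℚᵘ.≤-Reasoning

ι-mono-≤ : ∀ {a b} → a ≤ b → ι a ℚ.≤ ι b
ι-mono-≤ {a} {b} a≤b = subst₂ ℚ._≤_ (sym (ι≡mkℚ a)) (sym (ι≡mkℚ b))
  (ℚ.*≤* (subst₂ ℤ._≤_ (sym (ℤ.*-identityʳ _)) (sym (ℤ.*-identityʳ _)) (+≤+ a≤b)))

ι-cancel-≤ : ∀ {a b} → ι a ℚ.≤ ι b → a ≤ b
ι-cancel-≤ {a} {b} ιa≤ιb with subst₂ ℚ._≤_ (ι≡mkℚ a) (ι≡mkℚ b) ιa≤ιb
... | ℚ.*≤* a*1≤b*1 = ℤ.drop‿+≤+ (subst₂ ℤ._≤_ (ℤ.*-identityʳ _) (ℤ.*-identityʳ _) a*1≤b*1)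

ι-mono-< : ∀ {a b} → a < b → ι a ℚ.< ι b
ι-mono-< {a} {b} a<b = subst₂ ℚ._<_ (sym (ι≡mkℚ a)) (sym (ι≡mkℚ b))
  (ℚ.*<* (subst₂ ℤ._<_ (sym (ℤ.*-identityʳ _)) (sym (ℤ.*-identityʳ _)) (+<+ a<b)))

ι-cancel-< : ∀ {a b} → ι a ℚ.< ι b → a < b
ι-cancel-< {a} {b} ιa<ιb with subst₂ ℚ._<_ (ι≡mkℚ a) (ι≡mkℚ b) ιa<ιb
... | ℚ.*<* a*1<b*1 = ℤ.drop‿+<+ (subst₂ ℤ._<_ (ℤ.*-identityʳ _) (ℤ.*-identityʳ _) a*1<b*1)

ι-injective : ∀ {a b} → ι a ≡ ι b → a ≡ b
ι-injective ιa≡ιb = ≤-antisym (ι-cancel-≤ (ℚ.≤-reflexive ιa≡ιb)) (ι-cancel-≤ (ℚ.≤-reflexive (sym ιa≡ιb)))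

Σℚ-cong : ∀ {n} {f g : Fin n → ℚ} → (∀ i → f i ≡ g i) → Σℚ f ≡ Σℚ g
Σℚ-cong {zero}  _ = refl
Σℚ-cong {suc n} h = cong₂ ℚ._+_ (h F.zero) (Σℚ-cong (h ∘ F.suc))

Σℚ-zero : ∀ {n} {f : Fin n → ℚ} → (∀ i → f i ≡ 0ℚ) → Σℚ f ≡ 0ℚ
Σℚ-zero {zero}  _ = refl
Σℚ-zero {suc n} h = trans (cong₂ ℚ._+_ (h F.zero) (Σℚ-zero (h ∘ F.suc))) (ℚ.+-identityʳ 0ℚ)

Σℚ-single : ∀ {n} {f : Fin n → ℚ} a → (∀ i → i ≢ a → f i ≡ 0ℚ) → Σℚ f ≡ f a
Σℚ-single {f = f} F.zero h = trans (cong (f F.zero ℚ.+_) (Σℚ-zero (λ i → h (F.suc i) λ ()))) (ℚ.+-identityʳ _)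
Σℚ-single {f = f} (F.suc a) h =
  trans (cong (ℚ._+ Σℚ (f ∘ F.suc)) (h F.zero λ ()))
        (trans (ℚ.+-identityˡ _) (Σℚ-single a (λ i i≢a → h (F.suc i) (i≢a ∘ F.suc-injective))))

Σℚ-linear : ∀ {n} c (f g : Fin n → ℚ) → Σℚ (λ k → c ℚ.* f k ℚ.- g k) ≡ c ℚ.* Σℚ f ℚ.- Σℚ g
Σℚ-linear {zero}  c f g = solve 1 (λ c → con 0ℚ := c :* con 0ℚ :- con 0ℚ) refl c
Σℚ-linear {suc n} c f g =
  trans (cong (c ℚ.* f F.zero ℚ.- g F.zero ℚ.+_) (Σℚ-linear c (f ∘ F.suc) (g ∘ F.suc)))
        (solve 5 (λ c a b A B → (c :* a :- b) :+ (c :* A :- B) := c :* (a :+ A) :- (b :+ B)) refl c _ _ _ _)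

IsMin-exists : ∀ {n} .{{_ : NonZero n}} (x : Fin n → ℚ) → ∃ (IsMin x)
IsMin-exists {suc zero}    x = x F.zero , (λ { F.zero → ℚ.≤-refl }) , F.zero , refl
IsMin-exists {suc (suc n)} x with IsMin-exists (x ∘ F.suc)
... | c , c≤ , i , xi≡c with ℚ.≤-total (x F.zero) c
...   | inj₁ x0≤c = x F.zero , (λ { F.zero → ℚ.≤-refl ; (F.suc k) → ℚ.≤-trans x0≤c (c≤ k) }) , F.zero , refl
...   | inj₂ c≤x0 = c , (λ { F.zero → c≤x0 ; (F.suc k) → c≤ k }) , F.suc i , xi≡c

<min⇔<all : ∀ {n} .{{_ : NonZero n}} (x : Fin n → ℚ) a → (∃ λ c → IsMin x c × a ℚ.< c) ⇔ (∀ i → a ℚ.< x i)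
<min⇔<all x a = mk⇔
  (λ (c , (c≤ , _) , a<c) i → ℚ.<-≤-trans a<c (c≤ i))
  (λ a<x → let (c , min@(_ , i , xi≡c)) = IsMin-exists x in c , min , subst (a ℚ.<_) xi≡c (a<x i))

module _ (p : ℕ) .{{_ : NonZero p}} where

  fromDigits : ℕ → (ℕ → ℕ) → ℕ
  fromDigits L f = ∑[ j < L ] (f j * p ^ j)

  fromDigits-suc : ∀ L f → fromDigits (suc L) f ≡ f 0 + fromDigits L (f ∘ suc) * p
  fromDigits-suc L f = cong₂ _+_ (*-identityʳ (f 0)) (begin
    ∑[ j < L ] (f (suc j) * (p * p ^ j))  ≡⟨ sumBelow-cong L (λ j _ → x[yz]≡y[xz] (f (suc j)) p (p ^ j)) ⟩
    ∑[ j < L ] (p * (f (suc j) * p ^ j))  ≡⟨ *-distribˡ-sumBelow L p _ ⟨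
    p * fromDigits L (f ∘ suc)            ≡⟨ *-comm p _ ⟩
    fromDigits L (f ∘ suc) * p            ∎)
    where
    open ≡-Reasoning
    x[yz]≡y[xz] : ∀ x y z → x * (y * z) ≡ y * (x * z)
    x[yz]≡y[xz] = solve-∀

  digit-0 : ∀ j → digit p 0 j ≡ 0
  digit-0 zero    = m*n%n≡0 0 p
  digit-0 (suc j) = trans (cong (λ n → digit p n j) (0/n≡0 p)) (digit-0 j)

  digit-+*-zero : ∀ {r} q → r < p → digit p (r + q * p) 0 ≡ r
  digit-+*-zero q r<p = [r+qd]%d≡r _ q r<p

  digit-+*-suc : ∀ {r} q j → r < p → digit p (r + q * p) (suc j) ≡ digit p q j
  digit-+*-suc q j r<p = cong (λ n → digit p n j) ([r+qd]/d≡q _ q r<p)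

  digit-fromDigits-< : ∀ L f → (∀ j → f j < p) → ∀ {j} → j < L → digit p (fromDigits L f) j ≡ f j
  digit-fromDigits-< (suc L) f f<p {zero}  _ =
    trans (cong (λ n → digit p n 0) (fromDigits-suc L f)) (digit-+*-zero (fromDigits L (f ∘ suc)) (f<p 0))
  digit-fromDigits-< (suc L) f f<p {suc j} (s<s j<L) =
    trans (cong (λ n → digit p n (suc j)) (fromDigits-suc L f))
          (trans (digit-+*-suc (fromDigits L (f ∘ suc)) j (f<p 0)) (digit-fromDigits-< L (f ∘ suc) (f<p ∘ suc) j<L))

  digit-fromDigits-≥ : ∀ L f → (∀ j → f j < p) → ∀ {j} → L ≤ j → digit p (fromDigits L f) j ≡ 0
  digit-fromDigits-≥ zero    f f<p {j}     _ = digit-0 j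
  digit-fromDigits-≥ (suc L) f f<p {suc j} (s≤s L≤j) =
    trans (cong (λ n → digit p n (suc j)) (fromDigits-suc L f))
          (trans (digit-+*-suc (fromDigits L (f ∘ suc)) j (f<p 0)) (digit-fromDigits-≥ L (f ∘ suc) (f<p ∘ suc) L≤j))

  fromDigits-digit : ∀ L n → n < p ^ L → fromDigits L (digit p n) ≡ n
  fromDigits-digit zero    zero    _         = refl
  fromDigits-digit zero    (suc n) (s<s ())
  fromDigits-digit (suc L) n n<p^L = begin
    fromDigits (suc L) (digit p n)              ≡⟨ fromDigits-suc L (digit p n) ⟩
    n % p + fromDigits L (digit p (n / p)) * p  ≡⟨ cong (λ m → n % p + m * p) (fromDigits-digit L (n / p) n/p<p^L) ⟩
    n % p + n / p * p                           ≡⟨ m≡m%n+[m/n]*n n p ⟨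
    n                                           ∎
    where
    open ≡-Reasoning
    n/p<p^L : n / p < p ^ L
    n/p<p^L = m<n*o⇒m/o<n (subst (n <_) (*-comm p (p ^ L)) n<p^L)

  digit-Σℕ : ∀ {m} (X : Fin m → ℕ) → NoCarry p X → ∀ j → digit p (Σℕ X) j ≡ Σℕ (λ l → digit p (X l) j)
  digit-Σℕ {m} X noCarry j = trans (cong (λ n → digit p n j) ΣX≡) (go j)
    where
    ΣX≡ : Σℕ X ≡ Σℕ (λ l → X l % p) + Σℕ (λ l → X l / p) * p
    ΣX≡ = begin
      Σℕ X
        ≡⟨ Σℕ-cong (λ l → m≡m%n+[m/n]*n (X l) p) ⟩
      Σℕ (λ l → X l % p + X l / p * p)
        ≡⟨ Σℕ-distrib-+ {m} _ _ ⟩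
      Σℕ (λ l → X l % p) + Σℕ (λ l → X l / p * p)
        ≡⟨ cong (Σℕ (λ l → X l % p) +_) (Σℕ-cong (λ l → *-comm (X l / p) p)) ⟩
      Σℕ (λ l → X l % p) + Σℕ (λ l → p * (X l / p))
        ≡⟨ cong (Σℕ (λ l → X l % p) +_) (*-distribˡ-Σℕ {m} p _) ⟨
      Σℕ (λ l → X l % p) + p * Σℕ (λ l → X l / p)
        ≡⟨ cong (Σℕ (λ l → X l % p) +_) (*-comm p _) ⟩
      Σℕ (λ l → X l % p) + Σℕ (λ l → X l / p) * p ∎
      where open ≡-Reasoning
    go : ∀ j → digit p (Σℕ (λ l → X l % p) + Σℕ (λ l → X l / p) * p) j ≡ Σℕ (λ l → digit p (X l) j)
    go zero    = digit-+*-zero (Σℕ (λ l → X l / p)) (noCarry 0)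
    go (suc j) = trans (digit-+*-suc (Σℕ (λ l → X l / p)) j (noCarry 0)) (digit-Σℕ (λ l → X l / p) (noCarry ∘ suc) j)

  module _ (1<p : 1 < p) where

    n<p^n : ∀ n → n < p ^ n
    n<p^n zero    = z<s
    n<p^n (suc n) = begin-strict
      suc n          <⟨ s<s (n<p^n n) ⟩
      suc (p ^ n)    ≤⟨ +-monoˡ-≤ (p ^ n) (m^n>0 p n) ⟩
      p ^ n + p ^ n  ≡⟨ cong (p ^ n +_) (+-identityʳ (p ^ n)) ⟨
      2 * p ^ n      ≤⟨ *-monoˡ-≤ (p ^ n) 1<p ⟩
      p * p ^ n      ∎
      where open ≤-Reasoning

    n<p^[1+n] : ∀ n → n < p ^ suc n
    n<p^[1+n] n = <-trans (n<p^n n) (^-monoʳ-< p 1<p (n<1+n n))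

    digit-vanishes : ∀ {n j} → n < j → digit p n j ≡ 0
    digit-vanishes {zero}  {j}     _         = digit-0 j
    digit-vanishes {suc n} {suc j} (s<s n<j) = digit-vanishes (<-≤-trans (m/n<m (suc n) p 1<p) n<j)

-- Digit-class sums and the cyclic weight

module _ (p s : ℕ) .{{_ : NonZero p}} .{{_ : NonZero s}} (1<p : 1 < p) where

  0<s : 0 < s
  0<s = >-nonZero⁻¹ s

  toℕ-mod : ∀ n → toℕ (n mod s) ≡ n % s
  toℕ-mod n = F.toℕ-fromℕ< _

  mod-cong : ∀ {a b} → a % s ≡ b % s → a mod s ≡ b mod s
  mod-cong a≡b = F.toℕ-injective (trans (toℕ-mod _) (trans a≡b (sym (toℕ-mod _))))

  toℕ-mod-id : ∀ (i : Fin s) → toℕ i mod s ≡ i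
  toℕ-mod-id i = F.toℕ-injective (trans (toℕ-mod (toℕ i)) (m<n⇒m%n≡m (F.toℕ<n i)))

  %-cong-+ʳ : ∀ {a b} c → a % s ≡ b % s → (a + c) % s ≡ (b + c) % s
  %-cong-+ʳ {a} {b} c a≡b = begin
    (a + c) % s               ≡⟨ %-distribˡ-+ a c s ⟩
    (a % s + c % s) % s       ≡⟨ cong (λ x → (x + c % s) % s) a≡b ⟩
    (b % s + c % s) % s       ≡⟨ %-distribˡ-+ b c s ⟨
    (b + c) % s               ∎
    where open ≡-Reasoning

  %-cong-suc : ∀ {a b} → a % s ≡ b % s → suc a % s ≡ suc b % s
  %-cong-suc {a} {b} a≡b = subst₂ (λ x y → x % s ≡ y % s) (+-comm a 1) (+-comm b 1) (%-cong-+ʳ 1 a≡b)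

  %-mod : ∀ n → toℕ (n mod s) % s ≡ n % s
  %-mod n = trans (cong (_% s) (toℕ-mod n)) (m%n%n≡m%n n s)

  -- b + ((s ∸ 1) * b + a) = s * b + a, so every residue a is reached by moving forward from b.
  %-reach : ∀ a b → (b + ((s ∸ 1) * b + a)) % s ≡ a % s
  %-reach a b = trans (cong (_% s) b+[[s-1]b+a]≡a+b*s) ([m+kn]%n≡m%n a b s)
    where
    b+[[s-1]b+a]≡a+b*s : b + ((s ∸ 1) * b + a) ≡ a + b * s
    b+[[s-1]b+a]≡a+b*s = begin
      b + ((s ∸ 1) * b + a)     ≡⟨ +-assoc b _ a ⟨
      suc (s ∸ 1) * b + a       ≡⟨ cong (λ k → k * b + a) (suc-pred s) ⟩
      s * b + a                 ≡⟨ +-comm (s * b) a ⟩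
      a + s * b                 ≡⟨ cong (a +_) (*-comm s b) ⟩
      a + b * s                 ∎
      where open ≡-Reasoning

  classDigit : ℕ → Fin s → ℕ → ℕ
  classDigit n i j = if ⌊ j % s ≟ toℕ i ⌋ then digit p n j else 0

  classDigit-vanishes : ∀ {n i j} → digit p n j ≡ 0 → classDigit n i j ≡ 0
  classDigit-vanishes {n} {i} {j} dj≡0 =
    trans (cong (λ d → if ⌊ j % s ≟ toℕ i ⌋ then d else 0) dj≡0) (if-eta ⌊ j % s ≟ toℕ i ⌋)

  Γ-truncate : ∀ n i L → (∀ j → L ≤ j → digit p n j ≡ 0) → Γ p s n i ≡ sumBelow L (classDigit n i)
  Γ-truncate n i L vanish = begin
    Γ p s n i
      ≡⟨ sum-map-applyUpTo (suc n) (classDigit n i) id ⟩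
    sumBelow (suc n) (classDigit n i)
      ≡⟨ sumBelow-truncate _ (m≤m⊔n (suc n) L) (λ j n<j → classDigit-vanishes (digit-vanishes p 1<p n<j)) ⟨
    sumBelow (suc n ⊔ L) (classDigit n i)
      ≡⟨ sumBelow-truncate _ (m≤n⊔m (suc n) L) (λ j L≤j → classDigit-vanishes (vanish j L≤j)) ⟩
    sumBelow L (classDigit n i) ∎
    where open ≡-Reasoning

  Γ-0 : ∀ i → Γ p s 0 i ≡ 0
  Γ-0 i = Γ-truncate 0 i 0 (λ j _ → digit-0 p j)

  Γ-Σℕ : ∀ {m} (X : Fin m → ℕ) → NoCarry p X → ∀ i → Γ p s (Σℕ X) i ≡ Σℕ (λ l → Γ p s (X l) i)
  Γ-Σℕ X noCarry i = begin
    Γ p s (Σℕ X) i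
      ≡⟨ Γ-truncate (Σℕ X) i B (λ j B≤j → digit-vanishes p 1<p B≤j) ⟩
    sumBelow B (classDigit (Σℕ X) i)
      ≡⟨ sumBelow-cong B (λ j _ → classDigit-Σℕ j) ⟩
    ∑[ j < B ] Σℕ (λ l → classDigit (X l) i j)
      ≡⟨ sumBelow-Σℕ-comm B (λ l → classDigit (X l) i) ⟩
    Σℕ (λ l → sumBelow B (classDigit (X l) i))
      ≡⟨ Σℕ-cong (λ l → Γ-truncate (X l) i B (X-digits-vanish l)) ⟨
    Σℕ (λ l → Γ p s (X l) i) ∎
    where
    open ≡-Reasoning
    B = suc (Σℕ X)
    X-digits-vanish : ∀ l j → B ≤ j → digit p (X l) j ≡ 0
    X-digits-vanish l j B≤j = digit-vanishes p 1<p (<-≤-trans (s≤s (term≤Σℕ X l)) B≤j)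
    classDigit-Σℕ : ∀ j → classDigit (Σℕ X) i j ≡ Σℕ (λ l → classDigit (X l) i j)
    classDigit-Σℕ j = trans (cong (λ d → if ⌊ j % s ≟ toℕ i ⌋ then d else 0) (digit-Σℕ p X noCarry j))
                            (sym (Σℕ-if ⌊ j % s ≟ toℕ i ⌋ (λ l → digit p (X l) j)))

  Γ-nonzero : ∀ {n} → 0 < n → ∃[ i ] 0 < Γ p s n i
  Γ-nonzero {n} n>0
    with sumBelow>0⇒term>0 (suc n) (λ j → digit p n j * p ^ j)
           (subst (0 <_) (sym (fromDigits-digit p (suc n) n (n<p^[1+n] p 1<p n))) n>0)
  ... | j , j≤n , dj*p^j>0 = j mod s , (begin-strict
    0                                           <⟨ m*n>0⇒m>0 (digit p n j) dj*p^j>0 ⟩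
    digit p n j                                 ≡⟨ if-yes (j % s ≟ toℕ (j mod s)) (sym (toℕ-mod j)) ⟨
    classDigit n (j mod s) j                    ≤⟨ term≤sumBelow (suc n) (classDigit n (j mod s)) j≤n ⟩
    sumBelow (suc n) (classDigit n (j mod s))   ≡⟨ sum-map-applyUpTo (suc n) (classDigit n (j mod s)) id ⟨
    Γ p s n (j mod s)                           ∎)
    where open ≤-Reasoning

  Γ-nonzero⁻¹ : ∀ n → (∃ λ i → 0 < Γ p s n i) → 0 < n
  Γ-nonzero⁻¹ zero    (i , Γ0i>0) = contradiction (Γ-0 i) (>⇒≢ Γ0i>0)
  Γ-nonzero⁻¹ (suc n) _           = z<s

  cyc : (Fin s → ℕ) → ℕ → ℕ
  cyc v n = v (n mod s)

  cyc-cong : ∀ v {a b} → a % s ≡ b % s → cyc v a ≡ cyc v b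
  cyc-cong v = cong v ∘ mod-cong

  cyc-toℕ : ∀ v i → cyc v (toℕ i) ≡ v i
  cyc-toℕ v i = cong v (toℕ-mod-id i)

  cyc-+s : ∀ v n → cyc v (n + s) ≡ cyc v n
  cyc-+s v n = cyc-cong v ([m+n]%n≡m%n n s)

  partialWeight : (Fin s → ℕ) → ℕ → ℕ → ℕ
  partialWeight v j t = ∑[ i < t ] (p ^ i * cyc v (j + i))

  weight : (Fin s → ℕ) → ℕ → ℕ
  weight v j = partialWeight v j s

  Q : ℕ
  Q = p ^ s ∸ 1

  p^s≡1+Q : p ^ s ≡ suc Q
  p^s≡1+Q = sym (suc-pred (p ^ s) {{>-nonZero (m^n>0 p s)}})

  Q>0 : 0 < Q
  Q>0 = s<s⁻¹ (subst (1 <_) p^s≡1+Q (^-monoʳ-< p 1<p (>-nonZero⁻¹ s)))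

  instance
    Q≢0 : NonZero Q
    Q≢0 = >-nonZero Q>0

  partialWeight-cong : ∀ v {a b} t → a % s ≡ b % s → partialWeight v a t ≡ partialWeight v b t
  partialWeight-cong v t a≡b =
    sumBelow-cong t (λ i _ → cong (p ^ i *_) (cyc-cong v (%-cong-+ʳ i a≡b)))

  weight-cong-mod : ∀ v {a b} → a % s ≡ b % s → weight v a ≡ weight v b
  weight-cong-mod v = partialWeight-cong v s

  weight-everywhere : ∀ (P : ℕ → Set) v → (∀ (j : Fin s) → P (weight v (toℕ j))) → ∀ n → P (weight v n)
  weight-everywhere P v P-Fin n = subst P (weight-cong-mod v (%-mod n)) (P-Fin (n mod s))

  partialWeight-suc : ∀ v j t → partialWeight v j (suc t) ≡ cyc v j + p * partialWeight v (suc j) t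
  partialWeight-suc v j t = cong₂ _+_ (trans (*-identityˡ _) (cong (cyc v) (+-identityʳ j))) (begin
    ∑[ i < t ] (p * p ^ i * cyc v (j + suc i))
      ≡⟨ sumBelow-cong t (λ i _ → trans (*-assoc p (p ^ i) _) (cong (λ k → p * (p ^ i * cyc v k)) (+-suc j i))) ⟩
    ∑[ i < t ] (p * (p ^ i * cyc v (suc j + i)))
      ≡⟨ *-distribˡ-sumBelow t p _ ⟨
    p * partialWeight v (suc j) t ∎)
    where open ≡-Reasoning

  weight-rec : ∀ v j → p * weight v (suc j) ≡ weight v j + Q * cyc v j
  weight-rec v j = +-cancelʳ-≡ (cyc v j) _ _ (begin
    p * weight v (suc j) + cyc v j        ≡⟨ +-comm _ (cyc v j) ⟩
    cyc v j + p * weight v (suc j)        ≡⟨ partialWeight-suc v j s ⟨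
    partialWeight v j (suc s)             ≡⟨ sumBelow-init-last s _ ⟩
    weight v j + p ^ s * cyc v (j + s)    ≡⟨ cong₂ (λ a b → weight v j + a * b) p^s≡1+Q (cyc-+s v j) ⟩
    weight v j + suc Q * cyc v j          ≡⟨ a+[1+q]c≡a+qc+c (weight v j) Q (cyc v j) ⟩
    weight v j + Q * cyc v j + cyc v j    ∎)
    where
    open ≡-Reasoning
    a+[1+q]c≡a+qc+c : ∀ a q c → a + (1 + q) * c ≡ a + q * c + c
    a+[1+q]c≡a+qc+c = solve-∀

  weight-shift : ∀ v j t → p ^ t * weight v (j + t) ≡ weight v j + Q * partialWeight v j t
  weight-shift v j zero = begin
    1 * weight v (j + 0)   ≡⟨ trans (*-identityˡ _) (cong (weight v) (+-identityʳ j)) ⟩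
    weight v j             ≡⟨ +-identityʳ _ ⟨
    weight v j + 0         ≡⟨ cong (weight v j +_) (*-zeroʳ Q) ⟨
    weight v j + Q * 0     ∎
    where open ≡-Reasoning
  weight-shift v j (suc t) = begin
    p * p ^ t * weight v (j + suc t)                 ≡⟨ cong (λ k → p * p ^ t * weight v k) (+-suc j t) ⟩
    p * p ^ t * weight v (suc (j + t))               ≡⟨ xy[z]≡y[xz] p (p ^ t) (weight v (suc (j + t))) ⟩
    p ^ t * (p * weight v (suc (j + t)))             ≡⟨ cong (p ^ t *_) (weight-rec v (j + t)) ⟩
    p ^ t * (weight v (j + t) + Q * cyc v (j + t))   ≡⟨ x[a+yb]≡xa+y[xb] (p ^ t) (weight v (j + t)) Q (cyc v (j + t)) ⟩
    p ^ t * weight v (j + t) + Q * (p ^ t * cyc v (j + t))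
                                                     ≡⟨ cong (_+ Q * (p ^ t * cyc v (j + t))) (weight-shift v j t) ⟩
    weight v j + Q * partialWeight v j t + Q * (p ^ t * cyc v (j + t))
                                                     ≡⟨ a+qb+qc≡a+q[b+c] (weight v j) Q (partialWeight v j t) _ ⟩
    weight v j + Q * (partialWeight v j t + p ^ t * cyc v (j + t))
                                                     ≡⟨ cong (λ k → weight v j + Q * k) (sumBelow-init-last t _) ⟨
    weight v j + Q * partialWeight v j (suc t)       ∎
    where
    open ≡-Reasoning
    xy[z]≡y[xz] : ∀ x y z → x * y * z ≡ y * (x * z)
    xy[z]≡y[xz] = solve-∀
    x[a+yb]≡xa+y[xb] : ∀ x a y b → x * (a + y * b) ≡ x * a + y * (x * b)
    x[a+yb]≡xa+y[xb] = solve-∀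
    a+qb+qc≡a+q[b+c] : ∀ a q b c → a + q * b + q * c ≡ a + q * (b + c)
    a+qb+qc≡a+q[b+c] = solve-∀

  Q∣weight-pred : ∀ v j → Q ∣ weight v (suc j) → Q ∣ weight v j
  Q∣weight-pred v j Q∣w = ∣m+n∣m⇒∣n Q∣Qc+w (m∣m*n (cyc v j))
    where
    Q∣Qc+w : Q ∣ Q * cyc v j + weight v j
    Q∣Qc+w = subst (Q ∣_) (trans (weight-rec v j) (+-comm (weight v j) _)) (∣n⇒∣m*n p Q∣w)

  Q∣weight-+ : ∀ v j T → Q ∣ weight v (j + T) → Q ∣ weight v j
  Q∣weight-+ v j zero    = subst (λ k → Q ∣ weight v k) (+-identityʳ j)
  Q∣weight-+ v j (suc T) = Q∣weight-+ v j T ∘ Q∣weight-pred v (j + T) ∘ subst (λ k → Q ∣ weight v k) (+-suc j T)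

  Q∣weight-any : ∀ v a b → Q ∣ weight v a → Q ∣ weight v b
  Q∣weight-any v a b = Q∣weight-+ v b _ ∘ subst (Q ∣_) (weight-cong-mod v (sym (%-reach a b)))

  weight≡0-step : ∀ v j → weight v j ≡ 0 → cyc v j ≡ 0 × weight v (suc j) ≡ 0
  weight≡0-step v j w≡0 = c≡0 , *-cancelˡ-≡ _ 0 p (begin
    p * weight v (suc j)       ≡⟨ weight-rec v j ⟩
    weight v j + Q * cyc v j   ≡⟨ cong₂ (λ a b → a + Q * b) w≡0 c≡0 ⟩
    0 + Q * 0                  ≡⟨ *-zeroʳ Q ⟩
    0                          ≡⟨ *-zeroʳ p ⟨
    p * 0                      ∎)
    where
    open ≡-Reasoning
    c≤w : cyc v j ≤ weight v j
    c≤w = subst (_≤ weight v j) (trans (*-identityˡ _) (cong (cyc v) (+-identityʳ j)))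
                (term≤sumBelow s (λ t → p ^ t * cyc v (j + t)) 0<s)
    c≡0 : cyc v j ≡ 0
    c≡0 = n≤0⇒n≡0 (subst (cyc v j ≤_) w≡0 c≤w)

  weight≡0⇒cyc≡0 : ∀ v j → weight v j ≡ 0 → ∀ T → cyc v (j + T) ≡ 0
  weight≡0⇒cyc≡0 v j w≡0 zero    = trans (cong (cyc v) (+-identityʳ j)) (proj₁ (weight≡0-step v j w≡0))
  weight≡0⇒cyc≡0 v j w≡0 (suc T) =
    trans (cong (cyc v) (+-suc j T)) (weight≡0⇒cyc≡0 v (suc j) (proj₂ (weight≡0-step v j w≡0)) T)

  nonzero⇒weight>0 : ∀ v → (∃ λ i → 0 < v i) → ∀ j → 0 < weight v j
  nonzero⇒weight>0 v (i , vi>0) j = n≢0⇒n>0 λ w≡0 → <⇒≢ vi>0 (sym (begin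
    v i                                   ≡⟨ cyc-toℕ v i ⟨
    cyc v (toℕ i)                         ≡⟨ cyc-cong v (%-reach (toℕ i) j) ⟨
    cyc v (j + ((s ∸ 1) * j + toℕ i))     ≡⟨ weight≡0⇒cyc≡0 v j w≡0 _ ⟩
    0                                     ∎))
    where open ≡-Reasoning

  weight>0⇒nonzero : ∀ v j → 0 < weight v j → ∃ λ i → 0 < v i
  weight>0⇒nonzero v j w>0 with sumBelow>0⇒term>0 s (λ t → p ^ t * cyc v (j + t)) w>0
  ... | t , _ , term>0 = (j + t) mod s , m*n>0⇒n>0 (p ^ t) term>0

  weight-cong : ∀ {u v} → (∀ i → u i ≡ v i) → ∀ j → weight u j ≡ weight v j
  weight-cong u≗v j = sumBelow-cong s (λ t _ → cong (p ^ t *_) (u≗v _))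

  weight-+ : ∀ u v j → weight (λ i → u i + v i) j ≡ weight u j + weight v j
  weight-+ u v j = trans (sumBelow-cong s (λ t _ → *-distribˡ-+ (p ^ t) _ _))
                         (sumBelow-distrib-+ s (λ t → p ^ t * cyc u (j + t)) (λ t → p ^ t * cyc v (j + t)))

  weight-Σℕ : ∀ {m} (U : Fin m → Fin s → ℕ) j → weight (λ i → Σℕ (λ l → U l i)) j ≡ Σℕ (λ l → weight (U l) j)
  weight-Σℕ {m} U j = trans (sumBelow-cong s (λ t _ → *-distribˡ-Σℕ {m} (p ^ t) _))
                        (sumBelow-Σℕ-comm s (λ l t → p ^ t * cyc (U l) (j + t)))

  weight-Γ : ∀ n → weight (Γ p s n) 0 ≡ ∑[ j < suc n ] (p ^ (j % s) * digit p n j)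
  weight-Γ n = begin
    ∑[ t < s ] (p ^ t * Γ p s n (t mod s))
      ≡⟨ sumBelow-cong s (λ t _ → cong (p ^ t *_) (Γ-truncate n (t mod s) B digits-vanish)) ⟩
    ∑[ t < s ] (p ^ t * sumBelow B (classDigit n (t mod s)))
      ≡⟨ sumBelow-cong s (λ t _ → *-distribˡ-sumBelow B (p ^ t) (classDigit n (t mod s))) ⟩
    ∑[ t < s ] ∑[ j < B ] (p ^ t * classDigit n (t mod s) j)
      ≡⟨ sumBelow-comm s B (λ t j → p ^ t * classDigit n (t mod s) j) ⟩
    ∑[ j < B ] ∑[ t < s ] (p ^ t * classDigit n (t mod s) j)
      ≡⟨ sumBelow-cong B (λ j _ → only-residue j) ⟩
    ∑[ j < B ] (p ^ (j % s) * digit p n j) ∎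
    where
    open ≡-Reasoning
    B = suc n
    digits-vanish : ∀ j → B ≤ j → digit p n j ≡ 0
    digits-vanish j B≤j = digit-vanishes p 1<p B≤j
    toℕ-mod-< : ∀ {t} → t < s → toℕ (t mod s) ≡ t
    toℕ-mod-< t<s = trans (toℕ-mod _) (m<n⇒m%n≡m t<s)
    only-residue : ∀ j → ∑[ t < s ] (p ^ t * classDigit n (t mod s) j) ≡ p ^ (j % s) * digit p n j
    only-residue j = trans
      (sumBelow-single s (j % s) (m%n<n j s) (λ t t<s t≢ → trans
        (cong (p ^ t *_) (if-no (j % s ≟ toℕ (t mod s)) (λ j%s≡ → t≢ (sym (trans j%s≡ (toℕ-mod-< t<s))))))
        (*-zeroʳ (p ^ t))))
      (cong (p ^ (j % s) *_) (if-yes (j % s ≟ toℕ (j % s mod s)) (sym (toℕ-mod-< (m%n<n j s)))))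

  [p^s]^q%Q≡1%Q : ∀ q → (p ^ s) ^ q % Q ≡ 1 % Q
  [p^s]^q%Q≡1%Q zero    = refl
  [p^s]^q%Q≡1%Q (suc q) = begin
    (p ^ s * (p ^ s) ^ q) % Q                ≡⟨ %-distribˡ-* (p ^ s) _ Q ⟩
    (p ^ s % Q * ((p ^ s) ^ q % Q)) % Q      ≡⟨ cong₂ (λ a b → (a * b) % Q) p^s%Q≡1%Q ([p^s]^q%Q≡1%Q q) ⟩
    (1 % Q * (1 % Q)) % Q                    ≡⟨ %-distribˡ-* 1 1 Q ⟨
    1 % Q                                    ∎
    where
    open ≡-Reasoning
    p^s%Q≡1%Q : p ^ s % Q ≡ 1 % Q
    p^s%Q≡1%Q = trans (cong (_% Q) p^s≡1+Q) ([m+n]%n≡m%n 1 Q)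

  p^j%Q≡p^[j%s]%Q : ∀ j → p ^ j % Q ≡ p ^ (j % s) % Q
  p^j%Q≡p^[j%s]%Q j = begin
    p ^ j % Q
      ≡⟨ cong (λ k → p ^ k % Q) (trans (m≡m%n+[m/n]*n j s) (cong (j % s +_) (*-comm (j / s) s))) ⟩
    p ^ (j % s + s * (j / s)) % Q
      ≡⟨ cong (_% Q) (trans (^-distribˡ-+-* p (j % s) _) (cong (p ^ (j % s) *_) (sym (^-*-assoc p s (j / s))))) ⟩
    (p ^ (j % s) * (p ^ s) ^ (j / s)) % Q
      ≡⟨ %-distribˡ-* (p ^ (j % s)) _ Q ⟩
    (p ^ (j % s) % Q * ((p ^ s) ^ (j / s) % Q)) % Q
      ≡⟨ cong (λ a → (p ^ (j % s) % Q * a) % Q) ([p^s]^q%Q≡1%Q (j / s)) ⟩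
    (p ^ (j % s) % Q * (1 % Q)) % Q
      ≡⟨ %-distribˡ-* (p ^ (j % s)) 1 Q ⟨
    (p ^ (j % s) * 1) % Q
      ≡⟨ cong (_% Q) (*-identityʳ _) ⟩
    p ^ (j % s) % Q ∎
    where open ≡-Reasoning

  %Q≡weight-Γ%Q : ∀ n → n % Q ≡ weight (Γ p s n) 0 % Q
  %Q≡weight-Γ%Q n = begin
    n % Q                                            ≡⟨ cong (_% Q) (fromDigits-digit p (suc n) n (n<p^[1+n] p 1<p n)) ⟨
    fromDigits p (suc n) (digit p n) % Q             ≡⟨ sumBelow-%-cong {Q} (suc n) _ _ (λ j _ → term j) ⟩
    ∑[ j < suc n ] (p ^ (j % s) * digit p n j) % Q   ≡⟨ cong (_% Q) (weight-Γ n) ⟨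
    weight (Γ p s n) 0 % Q                           ∎
    where
    open ≡-Reasoning
    term : ∀ j → (digit p n j * p ^ j) % Q ≡ (p ^ (j % s) * digit p n j) % Q
    term j = begin
      (digit p n j * p ^ j) % Q                     ≡⟨ %-distribˡ-* (digit p n j) _ Q ⟩
      (digit p n j % Q * (p ^ j % Q)) % Q           ≡⟨ cong (λ a → (digit p n j % Q * a) % Q) (p^j%Q≡p^[j%s]%Q j) ⟩
      (digit p n j % Q * (p ^ (j % s) % Q)) % Q     ≡⟨ %-distribˡ-* (digit p n j) _ Q ⟨
      (digit p n j * p ^ (j % s)) % Q               ≡⟨ cong (_% Q) (*-comm (digit p n j) _) ⟩
      (p ^ (j % s) * digit p n j) % Q               ∎

  Q∣⇒Q∣weight-Γ : ∀ n → Q ∣ n → Q ∣ weight (Γ p s n) 0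
  Q∣⇒Q∣weight-Γ n Q∣n = m%n≡0⇒n∣m _ Q (trans (sym (%Q≡weight-Γ%Q n)) (n∣m⇒m%n≡0 n Q Q∣n))

  Q∣weight-Γ⇒Q∣ : ∀ n → Q ∣ weight (Γ p s n) 0 → Q ∣ n
  Q∣weight-Γ⇒Q∣ n Q∣w = m%n≡0⇒n∣m n Q (trans (%Q≡weight-Γ%Q n) (n∣m⇒m%n≡0 _ Q Q∣w))

  -- Peeling off a part with weight divisible by Q

  -- The y of the peeling step; taking the maximum over t < s is what gives
  -- y_j ≤ p·y_{j+1} and, when w_j > Q, p·y_{j+1} ∸ v_j ≤ y_j.
  level : (Fin s → ℕ) → ℕ → ℕ
  level v j = maxBelow s (λ t → p ^ t ∸ partialWeight v j t)

  level-cong-mod : ∀ v {a b} → a % s ≡ b % s → level v a ≡ level v b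
  level-cong-mod v a≡b = maxBelow-cong s (λ t _ → cong (p ^ t ∸_) (partialWeight-cong v t a≡b))

  level≥1 : ∀ v j → 1 ≤ level v j
  level≥1 v j = term≤maxBelow s (λ t → p ^ t ∸ partialWeight v j t) 0<s

  level-term-suc : ∀ v j t → p ^ suc t ∸ partialWeight v j (suc t) ≡ p * (p ^ t ∸ partialWeight v (suc j) t) ∸ cyc v j
  level-term-suc v j t = begin
    p * p ^ t ∸ partialWeight v j (suc t)   ≡⟨ cong (p * p ^ t ∸_) (trans (partialWeight-suc v j t) (+-comm (cyc v j) _)) ⟩
    p * p ^ t ∸ (p * A + cyc v j)           ≡⟨ ∸-+-assoc (p * p ^ t) (p * A) (cyc v j) ⟨
    p * p ^ t ∸ p * A ∸ cyc v j             ≡⟨ cong (_∸ cyc v j) (*-distribˡ-∸ p (p ^ t) A) ⟨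
    p * (p ^ t ∸ A) ∸ cyc v j               ∎
    where
    open ≡-Reasoning
    A = partialWeight v (suc j) t

  level≤p*level-suc : ∀ v j → level v j ≤ p * level v (suc j)
  level≤p*level-suc v j with maxBelow-attained (λ t → p ^ t ∸ partialWeight v j t) 0<s
  ... | zero , _ , level≡1 = begin
    level v j            ≡⟨ level≡1 ⟩
    1                    ≤⟨ level≥1 v (suc j) ⟩
    level v (suc j)      ≤⟨ m≤n*m _ p ⟩
    p * level v (suc j)  ∎
    where open ≤-Reasoning
  ... | suc t , t+1<s , level≡ = begin
    level v j                                           ≡⟨ trans level≡ (level-term-suc v j t) ⟩
    p * (p ^ t ∸ partialWeight v (suc j) t) ∸ cyc v j   ≤⟨ m∸n≤m _ (cyc v j) ⟩
    p * (p ^ t ∸ partialWeight v (suc j) t)             ≤⟨ *-monoʳ-≤ p (term≤maxBelow s _ (<-trans (n<1+n t) t+1<s)) ⟩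
    p * level v (suc j)                                 ∎
    where open ≤-Reasoning

  p*level-suc∸cyc≤level : ∀ v j → Q < weight v j → p * level v (suc j) ∸ cyc v j ≤ level v j
  p*level-suc∸cyc≤level v j Q<w with maxBelow-attained (λ t → p ^ t ∸ partialWeight v (suc j) t) 0<s
  ... | t , t<s , level≡ = begin
    p * level v (suc j) ∸ cyc v j                       ≡⟨ cong (λ x → p * x ∸ cyc v j) level≡ ⟩
    p * (p ^ t ∸ partialWeight v (suc j) t) ∸ cyc v j   ≡⟨ level-term-suc v j t ⟨
    p ^ suc t ∸ partialWeight v j (suc t)               ≤⟨ term≤level (m≤n⇒m<n∨m≡n t<s) ⟩
    level v j                                           ∎
    where
    open ≤-Reasoning
    term≤level : suc t < s ⊎ suc t ≡ s → p ^ suc t ∸ partialWeight v j (suc t) ≤ level v j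
    term≤level (inj₁ t+1<s) = term≤maxBelow s _ t+1<s
    term≤level (inj₂ t+1≡s) = subst (λ k → p ^ k ∸ partialWeight v j k ≤ level v j) (sym t+1≡s)
                                    (subst (_≤ level v j) (sym p^s∸weight≡0) z≤n)
      where
      p^s∸weight≡0 : p ^ s ∸ weight v j ≡ 0
      p^s∸weight≡0 = m≤n⇒m∸n≡0 (subst (_≤ weight v j) (sym p^s≡1+Q) Q<w)

  level-bound : ∀ N v → (∀ n → suc N * Q < weight v n) → ∀ j → Q * level v j + N * Q < weight v j
  level-bound N v big j with maxBelow-attained (λ t → p ^ t ∸ partialWeight v j t) 0<s
  ... | t , _ , level≡ = subst (λ x → Q * x + N * Q < weight v j) (sym level≡)
    (subst (λ x → x + N * Q < weight v j) (sym (*-distribˡ-∸ Q (p ^ t) A))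
      (a∸b+c<d QP+NQ<w+QA (≤-<-trans (m≤n+m (N * Q) Q) (big j))))
    where
    A = partialWeight v j t
    P = p ^ t
    QP+NQ<w+QA : Q * P + N * Q < weight v j + Q * A
    QP+NQ<w+QA = begin-strict
      Q * P + N * Q                 <⟨ n<1+n _ ⟩
      1 + (Q * P + N * Q)           ≤⟨ +-mono-≤ (m^n>0 p t) (+-monoʳ-≤ (Q * P) (m≤n*m (N * Q) P {{>-nonZero (m^n>0 p t)}})) ⟩
      P + (Q * P + P * (N * Q))     ≡⟨ x+[yx+x[zy]]≡x[1+[1+z]y] P Q N ⟩
      P * suc (suc N * Q)           ≤⟨ *-monoʳ-≤ P (big (j + t)) ⟩
      P * weight v (j + t)          ≡⟨ weight-shift v j t ⟩
      weight v j + Q * A            ∎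
      where
      open ≤-Reasoning
      x+[yx+x[zy]]≡x[1+[1+z]y] : ∀ x y z → x + (y * x + x * (z * y)) ≡ x * suc (suc z * y)
      x+[yx+x[zy]]≡x[1+[1+z]y] = solve-∀

  peeled : (Fin s → ℕ) → Fin s → ℕ
  peeled v i = p * level v (suc (toℕ i)) ∸ level v (toℕ i)

  cyc-peeled : ∀ v n → cyc (peeled v) n ≡ p * level v (suc n) ∸ level v n
  cyc-peeled v n = cong₂ (λ a b → p * a ∸ b) (level-cong-mod v (%-cong-suc (%-mod n))) (level-cong-mod v (%-mod n))

  peeled≤ : ∀ v → (∀ n → Q < weight v n) → ∀ i → peeled v i ≤ v i
  peeled≤ v Q<w i = m∸o≤n⇒m∸n≤o _ (level v (toℕ i)) (v i)
    (subst (λ c → p * level v (suc (toℕ i)) ∸ c ≤ level v (toℕ i)) (cyc-toℕ v i)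
      (p*level-suc∸cyc≤level v (toℕ i) (Q<w (toℕ i))))

  partialWeight-peeled : ∀ v T n → partialWeight (peeled v) n T + level v n ≡ p ^ T * level v (n + T)
  partialWeight-peeled v zero    n = sym (trans (*-identityˡ _) (cong (level v) (+-identityʳ n)))
  partialWeight-peeled v (suc T) n = begin
    partialWeight u n (suc T) + y n
      ≡⟨ cong (_+ y n) (partialWeight-suc u n T) ⟩
    cyc u n + p * partialWeight u (suc n) T + y n
      ≡⟨ a+b+c≡a+c+b (cyc u n) _ (y n) ⟩
    cyc u n + y n + p * partialWeight u (suc n) T
      ≡⟨ cong (λ c → c + y n + p * partialWeight u (suc n) T) (cyc-peeled v n) ⟩
    p * y (suc n) ∸ y n + y n + p * partialWeight u (suc n) T
                                                          ≡⟨ cong (_+ p * partialWeight u (suc n) T) (m∸n+n≡m (level≤p*level-suc v n)) ⟩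
    p * y (suc n) + p * partialWeight u (suc n) T
      ≡⟨ *-distribˡ-+ p _ _ ⟨
    p * (y (suc n) + partialWeight u (suc n) T)
      ≡⟨ cong (p *_) (+-comm (y (suc n)) _) ⟩
    p * (partialWeight u (suc n) T + y (suc n))
      ≡⟨ cong (p *_) (partialWeight-peeled v T (suc n)) ⟩
    p * (p ^ T * y (suc n + T))
      ≡⟨ *-assoc p (p ^ T) _ ⟨
    p * p ^ T * y (suc n + T)
      ≡⟨ cong (λ k → p * p ^ T * y k) (+-suc n T) ⟨
    p * p ^ T * y (n + suc T) ∎
    where
    open ≡-Reasoning
    u = peeled v
    y = level v
    a+b+c≡a+c+b : ∀ a b c → a + b + c ≡ a + c + b
    a+b+c≡a+c+b = solve-∀

  weight-peeled : ∀ v n → weight (peeled v) n ≡ Q * level v n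
  weight-peeled v n = +-cancelʳ-≡ (level v n) _ _ (begin
    weight (peeled v) n + level v n   ≡⟨ partialWeight-peeled v s n ⟩
    p ^ s * level v (n + s)           ≡⟨ cong₂ _*_ p^s≡1+Q (level-cong-mod v ([m+n]%n≡m%n n s)) ⟩
    suc Q * level v n                 ≡⟨ +-comm (level v n) _ ⟩
    Q * level v n + level v n         ∎)
    where open ≡-Reasoning

  peel : ∀ N v → (∀ n → suc N * Q < weight v n) →
         ∃ λ u → ∃ λ r → (∀ i → u i + r i ≡ v i) × (∃ λ i → 0 < u i) × Q ∣ weight u 0 × (∀ n → N * Q < weight r n)
  peel N v big = u , r , u+r≡v , u≢0 , Q∣weight-u , r-bound
    where
    u r : Fin s → ℕ
    u = peeled v
    r i = v i ∸ u i

    u+r≡v : ∀ i → u i + r i ≡ v i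
    u+r≡v i = m+[n∸m]≡n (peeled≤ v (λ n → ≤-<-trans (m≤m+n Q (N * Q)) (big n)) i)

    u≢0 : ∃ λ i → 0 < u i
    u≢0 = weight>0⇒nonzero u 0 (subst (0 <_) (sym (weight-peeled v 0)) (*-mono-≤ Q>0 (level≥1 v 0)))

    Q∣weight-u : Q ∣ weight u 0
    Q∣weight-u = subst (Q ∣_) (sym (weight-peeled v 0)) (m∣m*n (level v 0))

    r-bound : ∀ n → N * Q < weight r n
    r-bound n = +-cancelˡ-< (Q * level v n) _ _ (begin-strict
      Q * level v n + N * Q        <⟨ level-bound N v big n ⟩
      weight v n                   ≡⟨ weight-cong u+r≡v n ⟨
      weight (λ i → u i + r i) n   ≡⟨ weight-+ u r n ⟩
      weight u n + weight r n      ≡⟨ cong (_+ weight r n) (weight-peeled v n) ⟩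
      Q * level v n + weight r n   ∎)
      where open ≤-Reasoning

  -- The Γ-images of the tuples in V_m(k) for Γ(k) = v.
  Decomposition : ℕ → (Fin s → ℕ) → Set
  Decomposition m v = ∃ λ (U : Fin m → Fin s → ℕ) →
    (∀ l → ∃ λ i → 0 < U l i) × (∀ i → Σℕ (λ l → U l i) ≡ v i) × (∀ l → suc (toℕ l) < m → Q ∣ weight (U l) 0)

  decompose : ∀ N v → (∀ n → N * Q < weight v n) → Decomposition (suc N) v
  decompose zero    v big =
    (λ _ → v) , (λ _ → weight>0⇒nonzero v 0 (big 0)) , (λ i → +-identityʳ (v i)) , λ { F.zero (s<s ()) }
  decompose (suc N) v big with peel N v big
  ... | u , r , u+r≡v , u≢0 , Q∣weight-u , r-big with decompose N r r-big
  ...   | U , U≢0 , ΣU≡r , Q∣weight-U =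
    (λ { F.zero → u ; (F.suc l) → U l }) ,
    (λ { F.zero → u≢0 ; (F.suc l) → U≢0 l }) ,
    (λ i → trans (cong (u i +_) (ΣU≡r i)) (u+r≡v i)) ,
    (λ { F.zero _ → Q∣weight-u ; (F.suc l) (s<s l<N) → Q∣weight-U l l<N })

  decomposition⇒weight> : ∀ N v → Decomposition (suc N) v → ∀ n → N * Q < weight v n
  decomposition⇒weight> N v (U , U≢0 , ΣU≡v , Q∣weight-U) n =
    subst (N * Q <_) (trans (sym (weight-Σℕ U n)) (weight-cong ΣU≡v n))
      (n*q<Σℕ N (λ l → weight (U l) n) weight>0 Q≤weight)
    where
    weight>0 : ∀ l → 0 < weight (U l) n
    weight>0 l = nonzero⇒weight>0 (U l) (U≢0 l) n
    Q≤weight : ∀ l → suc (toℕ l) < suc N → Q ≤ weight (U l) n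
    Q≤weight l l<N = ∣⇒≤ {{>-nonZero (weight>0 l)}} (Q∣weight-any (U l) 0 n (Q∣weight-U l l<N))

  -- Carry-free realisation of digit-class vectors

  module _ {m : ℕ} .{{_ : NonZero m}} (U : Fin m → Fin s → ℕ) where

    -- Position j = (c·m + l′)·s + i′ (i′ < s, l′ < m) carries digit 1 in realisation l iff
    -- l′ = l and c < U_l(i′); so distinct realisations use disjoint positions, and
    -- Γ(realisation l)_i counts the c with c < U_l(i).
    realisingDigit : Fin m → ℕ → ℕ
    realisingDigit l j = if ⌊ (j / s) % m ≟ toℕ l ⌋ then (if (j / s) / m <ᵇ cyc (U l) j then 1 else 0) else 0

    realisingDigit≤1 : ∀ l j → realisingDigit l j ≤ 1
    realisingDigit≤1 l j with ⌊ (j / s) % m ≟ toℕ l ⌋ | (j / s) / m <ᵇ cyc (U l) j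
    ... | true  | true  = ≤-refl
    ... | true  | false = z≤n
    ... | false | _     = z≤n

    realisingDigit<p : ∀ l j → realisingDigit l j < p
    realisingDigit<p l j = <-≤-trans (s≤s (realisingDigit≤1 l j)) 1<p

    copies : ℕ
    copies = Σℕ (λ l → Σℕ (U l))

    numDigits : ℕ
    numDigits = copies * (m * s)

    realisation : Fin m → ℕ
    realisation l = fromDigits p numDigits (realisingDigit l)

    digit-realisation : ∀ l {j} → j < numDigits → digit p (realisation l) j ≡ realisingDigit l j
    digit-realisation l = digit-fromDigits-< p numDigits _ (realisingDigit<p l)

    digit-realisation≤ : ∀ l j → digit p (realisation l) j ≤ realisingDigit l j
    digit-realisation≤ l j with j <? numDigits
    ... | yes j<L = ≤-reflexive (digit-realisation l j<L)
    ... | no  j≮L = subst (_≤ realisingDigit l j) (sym (digit-fromDigits-≥ p numDigits _ (realisingDigit<p l) (≮⇒≥ j≮L))) z≤n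

    realisation-noCarry : NoCarry p realisation
    realisation-noCarry j = <-≤-trans (s≤s (begin
      Σℕ (λ l → digit p (realisation l) j)
        ≤⟨ Σℕ-mono-≤ (λ l → digit-realisation≤ l j) ⟩
      Σℕ (λ l → realisingDigit l j)
        ≡⟨ Σℕ-single block (λ l l≢block → if-no ((j / s) % m ≟ toℕ l) (l≢block ∘ block≡)) ⟩
      realisingDigit block j
        ≤⟨ realisingDigit≤1 block j ⟩
      1 ∎)) 1<p
      where
      open ≤-Reasoning
      block : Fin m
      block = (j / s) mod m
      block≡ : ∀ {l} → (j / s) % m ≡ toℕ l → l ≡ block
      block≡ eq = F.toℕ-injective (trans (sym eq) (sym (F.toℕ-fromℕ< _)))

    U≤copies : ∀ l i → U l i ≤ copies
    U≤copies l i = ≤-trans (term≤Σℕ (U l) i) (term≤Σℕ (λ l → Σℕ (U l)) l)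

    -- The summand of Γ(realisation l)_i at a position with coordinates i′, l′, c.
    cell : Fin m → Fin s → ℕ → ℕ → ℕ → ℕ → ℕ
    cell l i i′ l′ c u = if ⌊ i′ ≟ toℕ i ⌋ then (if ⌊ l′ ≟ toℕ l ⌋ then (if c <ᵇ u then 1 else 0) else 0) else 0

    position : ℕ → ℕ → ℕ → ℕ
    position c l′ i′ = c * (m * s) + (l′ * s + i′)

    cell-position : ∀ l i c {l′ i′} → l′ < m → i′ < s →
                    let j = position c l′ i′ in
                    cell l i (j % s) ((j / s) % m) ((j / s) / m) (cyc (U l) j) ≡ cell l i i′ l′ c (cyc (U l) i′)
    cell-position l i c {l′} {i′} l′<m i′<s =
      trans (cong₂ (λ a b → cell l i a b ((j / s) / m) (cyc (U l) j)) j%s≡i′ j/s%m≡l′)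
            (cong₂ (cell l i i′ l′) j/s/m≡c (cyc-cong (U l) (trans j%s≡i′ (sym (m<n⇒m%n≡m i′<s)))))
      where
      j = position c l′ i′
      j≡ : j ≡ i′ + (l′ + c * m) * s
      j≡ = c[ms]+[ls+i]≡i+[l+cm]s c m s l′ i′
        where
        c[ms]+[ls+i]≡i+[l+cm]s : ∀ c m s l i → c * (m * s) + (l * s + i) ≡ i + (l + c * m) * s
        c[ms]+[ls+i]≡i+[l+cm]s = solve-∀
      j%s≡i′ : j % s ≡ i′
      j%s≡i′ = trans (cong (_% s) j≡) ([r+qd]%d≡r i′ (l′ + c * m) i′<s)
      j/s≡ : j / s ≡ l′ + c * m
      j/s≡ = trans (cong (_/ s) j≡) ([r+qd]/d≡q i′ (l′ + c * m) i′<s)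
      j/s%m≡l′ : (j / s) % m ≡ l′
      j/s%m≡l′ = trans (cong (_% m) j/s≡) ([r+qd]%d≡r l′ c l′<m)
      j/s/m≡c : (j / s) / m ≡ c
      j/s/m≡c = trans (cong (_/ m) j/s≡) ([r+qd]/d≡q l′ c l′<m)

    cells-sum : ∀ l i c → ∑[ l′ < m ] ∑[ i′ < s ] cell l i i′ l′ c (cyc (U l) i′) ≡ (if c <ᵇ U l i then 1 else 0)
    cells-sum l i c = trans (sumBelow-cong m (λ l′ _ → sum-i′ l′)) sum-l′
      where
      sum-i′ : ∀ l′ → ∑[ i′ < s ] cell l i i′ l′ c (cyc (U l) i′) ≡ (if ⌊ l′ ≟ toℕ l ⌋ then (if c <ᵇ U l i then 1 else 0) else 0)
      sum-i′ l′ = trans (sumBelow-single s (toℕ i) (F.toℕ<n i) (λ i′ _ i′≢i → if-no (i′ ≟ toℕ i) i′≢i))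
                        (trans (if-yes (toℕ i ≟ toℕ i) refl)
                               (cong (λ u → if ⌊ l′ ≟ toℕ l ⌋ then (if c <ᵇ u then 1 else 0) else 0) (cyc-toℕ (U l) i)))
      sum-l′ : ∑[ l′ < m ] (if ⌊ l′ ≟ toℕ l ⌋ then (if c <ᵇ U l i then 1 else 0) else 0) ≡ (if c <ᵇ U l i then 1 else 0)
      sum-l′ = trans (sumBelow-single m (toℕ l) (F.toℕ<n l) (λ l′ _ l′≢l → if-no (l′ ≟ toℕ l) l′≢l))
                     (if-yes (toℕ l ≟ toℕ l) refl)

    Γ-realisation : ∀ l i → Γ p s (realisation l) i ≡ U l i
    Γ-realisation l i = begin
      Γ p s (realisation l) i
        ≡⟨ Γ-truncate (realisation l) i numDigits (λ j → digit-fromDigits-≥ p numDigits _ (realisingDigit<p l)) ⟩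
      sumBelow numDigits (classDigit (realisation l) i)
        ≡⟨ sumBelow-cong numDigits (λ j j<L → cong (λ d → if ⌊ j % s ≟ toℕ i ⌋ then d else 0) (digit-realisation l j<L)) ⟩
      ∑[ j < numDigits ] cell l i (j % s) ((j / s) % m) ((j / s) / m) (cyc (U l) j)
        ≡⟨ sumBelow-blocks copies (m * s) _ ⟩
      ∑[ c < copies ] ∑[ r < m * s ] cell′ (c * (m * s) + r)
        ≡⟨ sumBelow-cong copies (λ c _ → sumBelow-blocks m s _) ⟩
      ∑[ c < copies ] ∑[ l′ < m ] ∑[ i′ < s ] cell′ (position c l′ i′)
        ≡⟨ sumBelow-cong copies (λ c _ → sumBelow-cong m (λ l′ l′<m → sumBelow-cong s (λ i′ → cell-position l i c l′<m))) ⟩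
      ∑[ c < copies ] ∑[ l′ < m ] ∑[ i′ < s ] cell l i i′ l′ c (cyc (U l) i′)
        ≡⟨ sumBelow-cong copies (λ c _ → cells-sum l i c) ⟩
      ∑[ c < copies ] (if c <ᵇ U l i then 1 else 0)
        ≡⟨ sumBelow-count-< copies (U l i) (U≤copies l i) ⟩
      U l i ∎
      where
      open ≡-Reasoning
      cell′ : ℕ → ℕ
      cell′ j = cell l i (j % s) ((j / s) % m) ((j / s) / m) (cyc (U l) j)

  -- The sets I_m, 𝔍 and J_m in terms of the weight

  InI⇒Decomposition : ∀ m v → InI p s m v → Decomposition m v
  InI⇒Decomposition m v (k , Γk≗v , X , X>0 , ΣX≡k , noCarry , Q∣X) =
    (λ l → Γ p s (X l)) , (λ l → Γ-nonzero (X>0 l)) , ΣΓX≡v , (λ l l<m → Q∣⇒Q∣weight-Γ (X l) (Q∣X l l<m))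
    where
    ΣΓX≡v : ∀ i → Σℕ (λ l → Γ p s (X l) i) ≡ v i
    ΣΓX≡v i = trans (sym (Γ-Σℕ X noCarry i)) (trans (cong (λ k → Γ p s k i) ΣX≡k) (Γk≗v i))

  Decomposition⇒InI : ∀ N v → Decomposition (suc N) v → InI p s (suc N) v
  Decomposition⇒InI N v (U , U≢0 , ΣU≡v , Q∣weight-U) = Σℕ X , ΓΣX≗v , X , X>0 , refl , realisation-noCarry U , Q∣X
    where
    X : Fin (suc N) → ℕ
    X = realisation U
    ΓΣX≗v : ∀ i → Γ p s (Σℕ X) i ≡ v i
    ΓΣX≗v i = trans (Γ-Σℕ X (realisation-noCarry U) i) (trans (Σℕ-cong (λ l → Γ-realisation U l i)) (ΣU≡v i))
    X>0 : ∀ l → 0 < X l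
    X>0 l = let (i , Uli>0) = U≢0 l in Γ-nonzero⁻¹ (X l) (i , subst (0 <_) (sym (Γ-realisation U l i)) Uli>0)
    Q∣X : ∀ l → suc (toℕ l) < suc N → Q ∣ X l
    Q∣X l l<N = Q∣weight-Γ⇒Q∣ (X l) (subst (Q ∣_) (sym (weight-cong (Γ-realisation U l) 0)) (Q∣weight-U l l<N))

  InI⇔weight> : ∀ N v → InI p s (suc N) v ⇔ (∀ n → N * Q < weight v n)
  InI⇔weight> N v = mk⇔ (decomposition⇒weight> N v ∘ InI⇒Decomposition (suc N) v) (Decomposition⇒InI N v ∘ decompose N v)

  InJfrak⇔ : ∀ v → InJfrak p s v ⇔ ((∃ λ i → 0 < v i) × Q ∣ weight v 0)
  InJfrak⇔ v = mk⇔
    (λ (k , k>0 , Q∣k , Γk≗v) → let (i , Γki>0) = Γ-nonzero k>0 in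
      (i , subst (0 <_) (Γk≗v i) Γki>0) , subst (Q ∣_) (weight-cong Γk≗v 0) (Q∣⇒Q∣weight-Γ k Q∣k))
    (λ ((i , vi>0) , Q∣weight-v) →
      X , Γ-nonzero⁻¹ X (i , subst (0 <_) (sym (ΓX≗v i)) vi>0) ,
      Q∣weight-Γ⇒Q∣ X (subst (Q ∣_) (sym (weight-cong ΓX≗v 0)) Q∣weight-v) , ΓX≗v)
    where
    X : ℕ
    X = realisation (λ (_ : Fin 1) → v) F.zero
    ΓX≗v : ∀ i → Γ p s X i ≡ v i
    ΓX≗v = Γ-realisation (λ _ → v) F.zero

  InJ⇔weight : ∀ N v → InJ p s (suc N) v ⇔
               ((∀ n → suc N * Q ≤ weight v n) × ∃ λ (j : Fin s) → weight v (toℕ j) ≡ suc N * Q)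
  InJ⇔weight N v = mk⇔ fwd bwd
    where
    fwd : InJ p s (suc N) v → (∀ n → suc N * Q ≤ weight v n) × ∃ λ (j : Fin s) → weight v (toℕ j) ≡ suc N * Q
    fwd (inJfrak , inI , ¬inI) = mQ≤w , j , ≤-antisym (≮⇒≥ mQ≮wj) (mQ≤w (toℕ j))
      where
      mQ≤w : ∀ n → suc N * Q ≤ weight v n
      mQ≤w n = ∣∧<⇒≤ N (Q∣weight-any v 0 n (proj₂ (to (InJfrak⇔ v) inJfrak))) (to (InI⇔weight> N v) inI n)
      ∃mQ≮w : ∃ λ (j : Fin s) → ¬ (suc N * Q < weight v (toℕ j))
      ∃mQ≮w = F.¬∀⟶∃¬ s _ (λ j → suc N * Q <? weight v (toℕ j))
             (¬inI ∘ from (InI⇔weight> (suc N) v) ∘ weight-everywhere (suc N * Q <_) v)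
      j = proj₁ ∃mQ≮w
      mQ≮wj = proj₂ ∃mQ≮w
    bwd : (∀ n → suc N * Q ≤ weight v n) × (∃ λ (j : Fin s) → weight v (toℕ j) ≡ suc N * Q) → InJ p s (suc N) v
    bwd (mQ≤w , j , wj≡) = inJfrak , inI , ¬inI
      where
      inJfrak = from (InJfrak⇔ v)
        ( weight>0⇒nonzero v (toℕ j) (subst (0 <_) (sym wj≡) (<-≤-trans Q>0 (m≤m+n Q (N * Q))))
        , Q∣weight-any v (toℕ j) 0 (subst (Q ∣_) (sym wj≡) (n∣m*n (suc N))))
      inI = from (InI⇔weight> N v) (λ n → <-≤-trans (m<n+m (N * Q) Q>0) (mQ≤w n))
      ¬inI : ¬ InI p s (suc (suc N)) v
      ¬inI inI′ = <-irrefl (sym wj≡) (to (InI⇔weight> (suc N) v) inI′ (toℕ j))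

  -- The rational system E x = v

  next : Fin s → Fin s
  next j = suc (toℕ j) mod s

  [k+s]%s≡k : ∀ (k : Fin s) → (toℕ k + s) % s ≡ toℕ k
  [k+s]%s≡k k = trans ([m+n]%n≡m%n (toℕ k) s) (m<n⇒m%n≡m (F.toℕ<n k))

  1+[a+[s-1]]≡a+s : ∀ a → suc (a + (s ∸ 1)) ≡ a + s
  1+[a+[s-1]]≡a+s a = trans (sym (+-suc a (s ∸ 1))) (cong (a +_) (suc-pred s))

  next-prev : ∀ k → next (prev s k) ≡ k
  next-prev k = F.toℕ-injective (begin
    toℕ (next (prev s k))                 ≡⟨ toℕ-mod _ ⟩
    suc (toℕ (prev s k)) % s              ≡⟨ %-cong-suc (%-mod (toℕ k + (s ∸ 1))) ⟩
    suc (toℕ k + (s ∸ 1)) % s             ≡⟨ cong (_% s) (1+[a+[s-1]]≡a+s (toℕ k)) ⟩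
    (toℕ k + s) % s                       ≡⟨ [k+s]%s≡k k ⟩
    toℕ k                                 ∎)
    where open ≡-Reasoning

  prev-next : ∀ j → prev s (next j) ≡ j
  prev-next j = F.toℕ-injective (begin
    toℕ (prev s (next j))                 ≡⟨ toℕ-mod _ ⟩
    (toℕ (next j) + (s ∸ 1)) % s          ≡⟨ %-cong-+ʳ (s ∸ 1) (%-mod (suc (toℕ j))) ⟩
    (suc (toℕ j) + (s ∸ 1)) % s           ≡⟨ cong (_% s) (1+[a+[s-1]]≡a+s (toℕ j)) ⟩
    (toℕ j + s) % s                       ≡⟨ [k+s]%s≡k j ⟩
    toℕ j                                 ∎)
    where open ≡-Reasoning

  Emul-expand : ∀ x j → Emul p s x j ≡ ι p ℚ.* x (next j) ℚ.- x j
  Emul-expand x j = begin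
    Σℚ (λ k → x k ℚ.* (ι p ℚ.* e (prev s k) j ℚ.- e k j))
      ≡⟨ Σℚ-cong (λ k → distrib (x k) (ι p) (e (prev s k) j) (e k j)) ⟩
    Σℚ (λ k → ι p ℚ.* (x k ℚ.* e (prev s k) j) ℚ.- x k ℚ.* e k j)
      ≡⟨ Σℚ-linear {s} (ι p) _ _ ⟩
    ι p ℚ.* Σℚ (λ k → x k ℚ.* e (prev s k) j) ℚ.- Σℚ (λ k → x k ℚ.* e k j)
      ≡⟨ cong₂ (λ a b → ι p ℚ.* a ℚ.- b) picks-next picks-j ⟩
    ι p ℚ.* x (next j) ℚ.- x j ∎
    where
    open ≡-Reasoning
    distrib : ∀ x a b c → x ℚ.* (a ℚ.* b ℚ.- c) ≡ a ℚ.* (x ℚ.* b) ℚ.- x ℚ.* c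
    distrib = solve 4 (λ x a b c → x :* (a :* b :- c) := a :* (x :* b) :- x :* c) refl
    x*e-on : ∀ k → x k ℚ.* e j j ≡ x k
    x*e-on k = trans (cong (x k ℚ.*_) (if-yes (j F.≟ j) refl)) (ℚ.*-identityʳ (x k))
    x*e-off : ∀ {i} k → i ≢ j → x k ℚ.* e i j ≡ 0ℚ
    x*e-off {i} k i≢j = trans (cong (x k ℚ.*_) (if-no (i F.≟ j) i≢j)) (ℚ.*-zeroʳ (x k))
    picks-next : Σℚ (λ k → x k ℚ.* e (prev s k) j) ≡ x (next j)
    picks-next = trans (Σℚ-single (next j) (λ k k≢ → x*e-off k (k≢ ∘ prev≡j⇒≡next)))
                       (trans (cong (λ i → x (next j) ℚ.* e i j) (prev-next j)) (x*e-on (next j)))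
      where
      prev≡j⇒≡next : ∀ {k} → prev s k ≡ j → k ≡ next j
      prev≡j⇒≡next {k} prev≡j = trans (sym (next-prev k)) (cong next prev≡j)
    picks-j : Σℚ (λ k → x k ℚ.* e k j) ≡ x j
    picks-j = trans (Σℚ-single j (λ k k≢j → x*e-off k k≢j)) (x*e-on j)

  ιQ>0 : 0ℚ ℚ.< ι Q
  ιQ>0 = subst (ℚ._< ι Q) ι-0 (ι-mono-< Q>0)

  instance
    ιQ-positive : ℚ.Positive (ι Q)
    ιQ-positive = ℚ.positive ιQ>0

    ιQ-nonZero : ℚ.NonZero (ι Q)
    ιQ-nonZero = ℚ.>-nonZero ιQ>0

    ιQ-nonNegative : ℚ.NonNegative (ι Q)
    ιQ-nonNegative = ℚ.nonNegative (ℚ.<⇒≤ ιQ>0)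

  *ιQ-injective : ∀ {a b} → a ℚ.* ι Q ≡ b ℚ.* ι Q → a ≡ b
  *ιQ-injective aQ≡bQ = ℚ.≤-antisym (ℚ.*-cancelʳ-≤-pos (ι Q) (ℚ.≤-reflexive aQ≡bQ))
                                    (ℚ.*-cancelʳ-≤-pos (ι Q) (ℚ.≤-reflexive (sym aQ≡bQ)))

  ιQ*≡0⇒≡0 : ∀ {d} → ι Q ℚ.* d ≡ 0ℚ → d ≡ 0ℚ
  ιQ*≡0⇒≡0 {d} Qd≡0 = *ιQ-injective (trans (ℚ.*-comm d (ι Q)) (trans Qd≡0 (sym (ℚ.*-zeroˡ (ι Q)))))

  -- Going once around the cycle gives d_j = p^s·d_j.
  homogeneous⇒0 : ∀ (d : Fin s → ℚ) → (∀ j → d j ≡ ι p ℚ.* d (next j)) → ∀ j → d j ≡ 0ℚ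
  homogeneous⇒0 d d≡pd′ j = ιQ*≡0⇒≡0 (begin
    ι Q ℚ.* d j                        ≡⟨ solve 2 (λ q d → q :* d := (con 1ℚ :+ q) :* d :- d) refl (ι Q) (d j) ⟩
    (1ℚ ℚ.+ ι Q) ℚ.* d j ℚ.- d j       ≡⟨ cong (λ c → c ℚ.* d j ℚ.- d j) ι[p^s]≡1+ιQ ⟨
    ι (p ^ s) ℚ.* d j ℚ.- d j          ≡⟨ cong (ℚ._- d j) dj≡ι[p^s]*dj ⟨
    d j ℚ.- d j                        ≡⟨ ℚ.+-inverseʳ (d j) ⟩
    0ℚ                                 ∎)
    where
    open ≡-Reasoning
    D : ℕ → ℚ
    D n = d (n mod s)
    D-step : ∀ n → D n ≡ ι p ℚ.* D (suc n)
    D-step n = trans (d≡pd′ (n mod s)) (cong (λ i → ι p ℚ.* d i) (mod-cong (%-cong-suc (%-mod n))))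
    D-iterate : ∀ T n → D n ≡ ι (p ^ T) ℚ.* D (n + T)
    D-iterate zero    n = sym (trans (cong₂ ℚ._*_ ι-1 (cong D (+-identityʳ n))) (ℚ.*-identityˡ (D n)))
    D-iterate (suc T) n = begin
      D n
        ≡⟨ D-iterate T n ⟩
      ι (p ^ T) ℚ.* D (n + T)
        ≡⟨ cong (ι (p ^ T) ℚ.*_) (D-step (n + T)) ⟩
      ι (p ^ T) ℚ.* (ι p ℚ.* D (suc (n + T)))
        ≡⟨ ℚ.*-assoc (ι (p ^ T)) (ι p) _ ⟨
      ι (p ^ T) ℚ.* ι p ℚ.* D (suc (n + T))
        ≡⟨ cong₂ ℚ._*_ (trans (ℚ.*-comm (ι (p ^ T)) (ι p)) (sym (ι-homo-* p (p ^ T)))) (cong D (sym (+-suc n T))) ⟩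
      ι (p ^ suc T) ℚ.* D (n + suc T) ∎
    dj≡ι[p^s]*dj : d j ≡ ι (p ^ s) ℚ.* d j
    dj≡ι[p^s]*dj = begin
      d j
        ≡⟨ cong d (toℕ-mod-id j) ⟨
      D (toℕ j)
        ≡⟨ D-iterate s (toℕ j) ⟩
      ι (p ^ s) ℚ.* D (toℕ j + s)
        ≡⟨ cong (λ i → ι (p ^ s) ℚ.* d i) (trans (mod-cong ([m+n]%n≡m%n (toℕ j) s)) (toℕ-mod-id j)) ⟩
      ι (p ^ s) ℚ.* d j ∎
    ι[p^s]≡1+ιQ : ι (p ^ s) ≡ 1ℚ ℚ.+ ι Q
    ι[p^s]≡1+ιQ = trans (cong ι p^s≡1+Q) (trans (ι-homo-+ 1 Q) (cong (ℚ._+ ι Q) ι-1))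

  solution : (Fin s → ℕ) → Fin s → ℚ
  solution v j = ι (weight v (toℕ j)) ℚ.* ℚ.1/ ι Q

  solution*ιQ : ∀ v j → solution v j ℚ.* ι Q ≡ ι (weight v (toℕ j))
  solution*ιQ v j = begin
    ι w ℚ.* ℚ.1/ ι Q ℚ.* ι Q     ≡⟨ ℚ.*-assoc (ι w) (ℚ.1/ ι Q) (ι Q) ⟩
    ι w ℚ.* (ℚ.1/ ι Q ℚ.* ι Q)   ≡⟨ cong (ι w ℚ.*_) (ℚ.*-inverseˡ (ι Q)) ⟩
    ι w ℚ.* 1ℚ                   ≡⟨ ℚ.*-identityʳ (ι w) ⟩
    ι w                          ∎
    where
    open ≡-Reasoning
    w = weight v (toℕ j)

  Emul-solution : ∀ v j → Emul p s (solution v) j ≡ ι (v j)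
  Emul-solution v j = *ιQ-injective (begin
    Emul p s (solution v) j ℚ.* ι Q
      ≡⟨ cong (ℚ._* ι Q) (Emul-expand (solution v) j) ⟩
    (ι p ℚ.* solution v (next j) ℚ.- solution v j) ℚ.* ι Q
      ≡⟨ distrib (ι p) (solution v (next j)) (solution v j) (ι Q) ⟩
    ι p ℚ.* (solution v (next j) ℚ.* ι Q) ℚ.- solution v j ℚ.* ι Q
      ≡⟨ cong₂ (λ a b → ι p ℚ.* a ℚ.- b) (solution*ιQ v (next j)) (solution*ιQ v j) ⟩
    ι p ℚ.* ι (weight v (toℕ (next j))) ℚ.- ι (weight v (toℕ j))
      ≡⟨ cong (ℚ._- ι (weight v (toℕ j))) (sym (ι-homo-* p _)) ⟩
    ι (p * weight v (toℕ (next j))) ℚ.- ι (weight v (toℕ j))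
      ≡⟨ cong (λ w → ι (p * w) ℚ.- ι (weight v (toℕ j))) (weight-cong-mod v (%-mod (suc (toℕ j)))) ⟩
    ι (p * weight v (suc (toℕ j))) ℚ.- ι (weight v (toℕ j))
      ≡⟨ cong (λ w → ι w ℚ.- ι (weight v (toℕ j))) (weight-rec v (toℕ j)) ⟩
    ι (weight v (toℕ j) + Q * cyc v (toℕ j)) ℚ.- ι (weight v (toℕ j))
      ≡⟨ cong (ℚ._- ι (weight v (toℕ j))) (ι-homo-+ (weight v (toℕ j)) _) ⟩
    ι (weight v (toℕ j)) ℚ.+ ι (Q * cyc v (toℕ j)) ℚ.- ι (weight v (toℕ j))
                                                                     ≡⟨ solve 2 (λ w c → w :+ c :- w := c) refl (ι (weight v (toℕ j))) (ι (Q * cyc v (toℕ j))) ⟩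
    ι (Q * cyc v (toℕ j))
      ≡⟨ cong ι (trans (*-comm Q _) (cong (_* Q) (cyc-toℕ v j))) ⟩
    ι (v j * Q)
      ≡⟨ ι-homo-* (v j) Q ⟩
    ι (v j) ℚ.* ι Q ∎)
    where
    open ≡-Reasoning
    distrib : ∀ a b c d → (a ℚ.* b ℚ.- c) ℚ.* d ≡ a ℚ.* (b ℚ.* d) ℚ.- c ℚ.* d
    distrib = solve 4 (λ a b c d → (a :* b :- c) :* d := a :* (b :* d) :- c :* d) refl

  Emul-unique : ∀ v x → (∀ j → Emul p s x j ≡ ι (v j)) → ∀ j → x j ≡ solution v j
  Emul-unique v x Ex≡v j = begin
    x j                                        ≡⟨ solve 2 (λ x y → x := y :+ (x :- y)) refl (x j) (solution v j) ⟩
    solution v j ℚ.+ (x j ℚ.- solution v j)    ≡⟨ cong (solution v j ℚ.+_) (homogeneous⇒0 d d≡pd′ j) ⟩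
    solution v j ℚ.+ 0ℚ                        ≡⟨ ℚ.+-identityʳ _ ⟩
    solution v j                               ∎
    where
    open ≡-Reasoning
    d : Fin s → ℚ
    d k = x k ℚ.- solution v k
    d≡pd′ : ∀ k → d k ≡ ι p ℚ.* d (next k)
    d≡pd′ k = begin
      x k ℚ.- solution v k
        ≡⟨ rearrange (ι p) (x (next k)) (x k) (solution v (next k)) (solution v k) ⟩
      ι p ℚ.* d (next k) ℚ.- (Ex k ℚ.- Esolution k)
        ≡⟨ cong (λ z → ι p ℚ.* d (next k) ℚ.- z) Ex-Esolution≡0 ⟩
      ι p ℚ.* d (next k) ℚ.- 0ℚ
        ≡⟨ solve 1 (λ a → a :- con 0ℚ := a) refl (ι p ℚ.* d (next k)) ⟩
      ι p ℚ.* d (next k) ∎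
      where
      Ex Esolution : Fin s → ℚ
      Ex k = ι p ℚ.* x (next k) ℚ.- x k
      Esolution k = ι p ℚ.* solution v (next k) ℚ.- solution v k
      Ex-Esolution≡0 : Ex k ℚ.- Esolution k ≡ 0ℚ
      Ex-Esolution≡0 = begin
        Ex k ℚ.- Esolution k         ≡⟨ cong₂ ℚ._-_ (trans (sym (Emul-expand x k)) (Ex≡v k))
                                                     (trans (sym (Emul-expand (solution v) k)) (Emul-solution v k)) ⟩
        ι (v k) ℚ.- ι (v k)          ≡⟨ ℚ.+-inverseʳ (ι (v k)) ⟩
        0ℚ                           ∎
      rearrange : ∀ a x′ x y′ y → x ℚ.- y ≡ a ℚ.* (x′ ℚ.- y′) ℚ.- ((a ℚ.* x′ ℚ.- x) ℚ.- (a ℚ.* y′ ℚ.- y))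
      rearrange = solve 5 (λ a x′ x y′ y → x :- y := a :* (x′ :- y′) :- ((a :* x′ :- x) :- (a :* y′ :- y))) refl

  ι<solution⇔ : ∀ a v j → ι a ℚ.< solution v j ⇔ a * Q < weight v (toℕ j)
  ι<solution⇔ a v j = mk⇔
    (λ ιa<x → ι-cancel-< (subst₂ ℚ._<_ (sym (ι-homo-* a Q)) (solution*ιQ v j) (ℚ.*-monoˡ-<-pos (ι Q) ιa<x)))
    (λ aQ<w → ℚ.*-cancelʳ-<-nonNeg (ι Q) (subst₂ ℚ._<_ (ι-homo-* a Q) (sym (solution*ιQ v j)) (ι-mono-< aQ<w)))

  ι≤solution⇔ : ∀ a v j → ι a ℚ.≤ solution v j ⇔ a * Q ≤ weight v (toℕ j)
  ι≤solution⇔ a v j = mk⇔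
    (λ ιa≤x → ι-cancel-≤ (subst₂ ℚ._≤_ (sym (ι-homo-* a Q)) (solution*ιQ v j) (ℚ.*-monoʳ-≤-nonNeg (ι Q) ιa≤x)))
    (λ aQ≤w → ℚ.*-cancelʳ-≤-pos (ι Q) (subst₂ ℚ._≤_ (ι-homo-* a Q) (sym (solution*ιQ v j)) (ι-mono-≤ aQ≤w)))

  solution≡ι⇔ : ∀ a v j → solution v j ≡ ι a ⇔ weight v (toℕ j) ≡ a * Q
  solution≡ι⇔ a v j = mk⇔
    (λ x≡ιa → ι-injective (trans (sym (solution*ιQ v j)) (trans (cong (ℚ._* ι Q) x≡ιa) (sym (ι-homo-* a Q)))))
    (λ w≡aQ → *ιQ-injective (trans (solution*ιQ v j) (trans (cong ι w≡aQ) (ι-homo-* a Q))))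

  weight>⇔min> : ∀ N v → (∀ n → N * Q < weight v n) ⇔
                 (∃ λ x → (∀ i → Emul p s x i ≡ ι (v i)) × ∃ λ c → IsMin x c × ι N ℚ.< c)
  weight>⇔min> N v = mk⇔
    (λ N*Q<w → solution v , Emul-solution v ,
      from (<min⇔<all (solution v) (ι N)) (λ j → from (ι<solution⇔ N v j) (N*Q<w (toℕ j))))
    (λ (x , Ex≡v , min>N) → weight-everywhere (N * Q <_) v λ j →
      to (ι<solution⇔ N v j)
        (subst (ι N ℚ.<_) (Emul-unique v x Ex≡v j) (to (<min⇔<all x (ι N)) min>N j)))

  weight≥∧≡⇔min≡ : ∀ a v → ((∀ n → a * Q ≤ weight v n) × ∃ λ (j : Fin s) → weight v (toℕ j) ≡ a * Q) ⇔
                   (∃ λ x → (∀ i → Emul p s x i ≡ ι (v i)) × IsMin x (ι a))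
  weight≥∧≡⇔min≡ a v = mk⇔
    (λ (a*Q≤w , j , wj≡a*Q) → solution v , Emul-solution v ,
      (λ k → from (ι≤solution⇔ a v k) (a*Q≤w (toℕ k))) , j , from (solution≡ι⇔ a v j) wj≡a*Q)
    (λ (x , Ex≡v , ιa≤x , j , xj≡ιa) →
      weight-everywhere (a * Q ≤_) v (λ k → to (ι≤solution⇔ a v k) (subst (ι a ℚ.≤_) (Emul-unique v x Ex≡v k) (ιa≤x k))) ,
      j , to (solution≡ι⇔ a v j) (trans (sym (Emul-unique v x Ex≡v j)) xj≡ιa))

proposition4p3 : (p s : ℕ) → .{{_ : NonZero p}} → .{{_ : NonZero s}} → Prime p →
    (m : ℕ) → 1 ≤ m →
    (∀ (v : Fin s → ℕ) → InI p s m v ⇔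
        (∃ λ (x : Fin s → ℚ) → (∀ i → Emul p s x i ≡ ι (v i)) ×
          (∃ λ c → IsMin x c × ι (m ∸ 1) ℚ.< c)))
    × (∀ (v : Fin s → ℕ) → InJ p s m v ⇔
        (∃ λ (a : Fin s → ℚ) → (∀ i → Emul p s a i ≡ ι (v i)) × IsMin a (ι m)))
proposition4p3 p s (prime {{p-nonTrivial}} _) (suc N) _ =
  (λ v → ⇔.trans (InI⇔weight> p s 1<p N v) (weight>⇔min> p s 1<p N v)) ,
  (λ v → ⇔.trans (InJ⇔weight p s 1<p N v) (weight≥∧≡⇔min≡ p s 1<p (suc N) v))
  where
  1<p : 1 < p
  1<p = nonTrivial⇒n>1 p {{p-nonTrivial}}
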